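{- Let $n\ge1$ and let $\Phi^+$ be the positive root system of type $\widetilde{A}_{n-1}$ realized as $\{\widetilde{e}_j-\widetilde{e}_i : i<j,\ i\not\equiv j \bmod n\}$. The collection of all biclosed subsets of $\Phi^+$, ordered by containment, is a complete lattice. For any collection $\mathcal{X}$ of biclosed sets, $\bigvee\mathcal{X}=\overline{\bigcup_{J\in\mathcal{X}}J}$ and $\bigwedge\mathcal{X}=\big(\bigcap_{J\in\mathcal{X}}J\big)^{\circ}$.
   Context: Let $\widehat V$ be the real vector space spanned by vectors $\widetilde{e}_i$, $i\in\mathbb{Z}$, modulo the relations $\widetilde{e}_{i+n}-\widetilde{e}_i=\widetilde{e}_{j+n}-\widetilde{e}_j$ for all $i,j$. The positive roots are the vectors $\widetilde{e}_j-\widetilde{e}_i$ with $i<j$, $i\not\equiv j\bmod n$ (these correspond to the pairs $(i,j)$ modulo simultaneous translation by $(n,n)$). A subset $J\subseteq\Phi^+$ is closed if whenever $\alpha,\beta\in J$, $\gamma\in\Phi^+$ and $\gamma\in\mathbb{R}_{>0}\alpha+\mathbb{R}_{>0}\beta$, then $\gamma\in J$; coclosed if $\Phi^+\setminus J$ is closed; biclosed if both. The closure $\overline{K}$ of $K\subseteq\Phi^+$ is the intersection of all closed sets containing $K$; the interior $K^\circ$ is the union of all coclosed sets contained in $K$. -}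

module Defs where

open import Level using (0ℓ)
open import Data.Nat as ℕ using (ℕ; NonZero; _≡ᵇ_)
open import Data.Integer as ℤ using (ℤ; +_; _<_)
open import Data.Integer.DivMod using (_/ℕ_; _%ℕ_)
open import Data.Integer.Divisibility using (_∣_)
open import Data.Fin using (Fin; toℕ)
open import Data.Vec using (Vec; tabulate; zipWith; map)
open import Data.Bool using (if_then_else_)
open import Data.Product using (Σ; ∃; _×_; _,_)
open import Relation.Nullary using (¬_)
open import Relation.Binary.PropositionalEquality using (_≡_)
open import Relation.Unary using (Pred; _⊆_)

-- Coordinates on the real span V̂ of the ẽ_i modulo ẽ_{i+n} - ẽ_i = δ :
-- V̂ has basis ẽ_0, …, ẽ_{n-1}, δ ; a vector is (Vec of ẽ_k-coefficients , δ-coefficient).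
-- All roots have integer coordinates, so we work in the integer lattice.
V : ℕ → Set
V n = Vec ℤ n × ℤ

_+ᵥ_ : ∀ {n} → V n → V n → V n
(u , a) +ᵥ (w , b) = zipWith ℤ._+_ u w , a ℤ.+ b

_-ᵥ_ : ∀ {n} → V n → V n → V n
(u , a) -ᵥ (w , b) = zipWith ℤ._-_ u w , a ℤ.- b

_·ᵥ_ : ∀ {n} → ℕ → V n → V n
k ·ᵥ (u , a) = map (+ k ℤ.*_) u , + k ℤ.* a

-- ẽ_i = ẽ_{i mod n} + ⌊i/n⌋ δ
ẽ : ∀ n .{{_ : NonZero n}} → ℤ → V n
ẽ n i = tabulate (λ k → if toℕ k ≡ᵇ (i %ℕ n) then + 1 else + 0) , i /ℕ n

module _ (n : ℕ) .{{_ : NonZero n}} where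

  Φ⁺ : Pred (V n) 0ℓ
  Φ⁺ v = ∃ λ i → ∃ λ j → i < j × ¬ (+ n ∣ (j ℤ.- i)) × v ≡ (ẽ n j -ᵥ ẽ n i)

  -- γ ∈ ℝ_{>0} α + ℝ_{>0} β  (for lattice vectors: c γ = a α + b β, a b c positive integers)
  InCone : V n → V n → V n → Set
  InCone γ α β = Σ ℕ λ a → Σ ℕ λ b → Σ ℕ λ c →
    NonZero a × NonZero b × NonZero c × (c ·ᵥ γ) ≡ ((a ·ᵥ α) +ᵥ (b ·ᵥ β))

  Closed : ∀ {ℓ} → Pred (V n) ℓ → Set ℓ
  Closed J = ∀ α β γ → J α → J β → Φ⁺ γ → InCone γ α β → J γ

  Compl : ∀ {ℓ} → Pred (V n) ℓ → Pred (V n) ℓ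
  Compl J v = Φ⁺ v × ¬ J v

  Coclosed : ∀ {ℓ} → Pred (V n) ℓ → Set ℓ
  Coclosed J = Closed (Compl J)

  Biclosed : ∀ {ℓ} → Pred (V n) ℓ → Set ℓ
  Biclosed J = J ⊆ Φ⁺ × Closed J × Coclosed J

  closure : ∀ {ℓ} → Pred (V n) ℓ → Pred (V n) _
  closure {ℓ} K v = Φ⁺ v × ((C : Pred (V n) 0ℓ) → C ⊆ Φ⁺ → Closed C → K ⊆ C → C v)

  interior : ∀ {ℓ} → Pred (V n) ℓ → Pred (V n) _
  interior K v = Σ (Pred (V n) 0ℓ) λ C → C ⊆ Φ⁺ × Coclosed C × C ⊆ K × C v

{-# OPTIONS --safe #-}
module Submission where

open import Level using (0ℓ)
open import Data.Bool using (T; true; false; if_then_else_)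
open import Data.Empty using (⊥; ⊥-elim)
open import Data.Fin using (Fin; toℕ; fromℕ<)
import Data.Fin.Properties as Fin
open import Data.Integer as ℤ using (ℤ; +_; +0; +[1+_]; _+_; _-_; _*_; -_; _<_; _≤_; +<+; +≤+; 0ℤ; 1ℤ)
open import Data.Integer.DivMod using (_/ℕ_; _%ℕ_; a≡a%ℕn+[a/ℕn]*n; n%ℕd<d)
open import Data.Integer.Divisibility using (_∣_)
open import Data.Integer.Divisibility.Signed using (divides; ∣ᵤ⇒∣; ∣⇒∣ᵤ)
open import Data.Integer.Properties
open import Data.Integer.Tactic.RingSolver using (solve-∀)
open import Data.Nat as ℕ using (ℕ; NonZero; _≡ᵇ_)
open import Data.Nat.Induction using (<-rec)
import Data.Nat.Properties as ℕ
open import Data.Product using (Σ; _×_; _,_; proj₁; proj₂)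
open import Data.Sum using (_⊎_; inj₁; inj₂; swap) renaming ([_,_] to either)
open import Data.Vec using (lookup; tabulate)
import Data.Vec.Properties as Vec
open import Function using (_∘_)
open import Relation.Binary.Construct.Closure.ReflexiveTransitive using (Star; ε; _◅_)
open import Relation.Binary.Construct.Closure.Transitive using (TransClosure; [_]; _∷_; _++_)
open import Relation.Binary.Definitions using (tri<; tri≈; tri>)
open import Relation.Binary.PropositionalEquality hiding ([_])
open import Relation.Nullary using (¬_; Dec; yes; no; contradiction)
open import Relation.Nullary.Decidable using (map′)
open import Relation.Unary using (Pred; _⊆_; _≐_; ⋃; ⋂)
open import Defs

-- A positive root is written as a pair: root i j = ẽ_j - ẽ_i with i < j and i ≢ j (mod n), and
-- root (i + tn) (j + tn) = root i j. Joins and meets reduce to one fact: the closure of a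
-- coclosed set S is coclosed (the meet is then the complement of the closure of the complement
-- of the intersection). Up to swapping α and β, a relation γ ∈ ℝ>0 α + ℝ>0 β between positive
-- roots with γ = (i, k) has one of four shapes: α = γ; α and β concatenate to γ (split); α and
-- β start at i and end in the class of k on both sides of k (fan); or α = (i, k₁) with k₁ ≡ k
-- below k and β = (k', i') with k' ≡ k, i' ≡ i (wrap). Let Reach be generated by the pairs of S,
-- by composition, and by winding a ↦ a + cn (c > 0) whenever S contains a chain from a to a + dn.
-- Shape by shape, Reach lies in the closure and the closure lies in Reach up to double negation,
-- so it suffices that Reach is coclosed. The heart of this is the split case at a point u on
-- such a cycle: every x strictly between u and u + n is reachable from u or reaches u + n. This
-- goes by induction on the length of the cycle, looking at the edge of the cycle that jumps
-- over u + n.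

module Congruence (n : ℕ) .{{_ : NonZero n}} where

  N : ℤ
  N = + n

  0<N : 0ℤ < N
  0<N = +<+ (ℕ.>-nonZero⁻¹ n)

  instance
    N-positive : ℤ.Positive N
    N-positive = ℤ.positive 0<N

  i<i+1 : ∀ i → i < i + 1ℤ
  i<i+1 i = subst (i <_) (+-comm 1ℤ i) (suc[i]≤j⇒i<j ≤-refl)

  i<j⇒0<j-i : ∀ {i j} → i < j → 0ℤ < j - i
  i<j⇒0<j-i {i} {j} i<j = subst (_< j - i) (+-inverseʳ i) (+-monoˡ-< (- i) i<j)

  0<j-i⇒i<j : ∀ {i j} → 0ℤ < j - i → i < j
  0<j-i⇒i<j {i} {j} 0<j-i = subst₂ _<_ (+-identityˡ i) (lemma i j) (+-monoˡ-< i 0<j-i)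
    where
    lemma : ∀ i j → j - i + i ≡ j
    lemma = solve-∀

  ≤⇒≡⊎< : ∀ {i j} → i ≤ j → i ≡ j ⊎ i < j
  ≤⇒≡⊎< {i} {j} i≤j with i ≟ j
  ... | yes i≡j = inj₁ i≡j
  ... | no i≢j = inj₂ (≤∧≢⇒< i≤j i≢j)

  infixl 6 _⊕_
  -- Opaque, so that a ⊕ t stays rigid under unification instead of unfolding into integer arithmetic.
  opaque
    _⊕_ : ℤ → ℤ → ℤ
    a ⊕ t = a + t * N

  opaque
    unfolding _⊕_

    ⊕-identityʳ : ∀ a → a ⊕ 0ℤ ≡ a
    ⊕-identityʳ a = trans (cong (λ x → a + x) (*-zeroˡ N)) (+-identityʳ a)

    ⊕-assoc : ∀ a s t → a ⊕ s ⊕ t ≡ a ⊕ (s + t)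
    ⊕-assoc a s t = lemma a s t N
      where
      lemma : ∀ a s t N → a + s * N + t * N ≡ a + (s + t) * N
      lemma = solve-∀

    +-⊕-assoc : ∀ a b t → a + b ⊕ t ≡ a + (b ⊕ t)
    +-⊕-assoc a b t = +-assoc a b (t * N)

    ⊕-+-comm : ∀ a b t → a + b ⊕ t ≡ a ⊕ t + b
    ⊕-+-comm a b t = lemma a b t N
      where
      lemma : ∀ a b t N → a + b + t * N ≡ a + t * N + b
      lemma = solve-∀

    ⊕-1 : ∀ a → a ⊕ 1ℤ ≡ a + N
    ⊕-1 a = cong (λ x → a + x) (*-identityˡ N)

    ≤-⊕ : ∀ a {t} → 0ℤ ≤ t → a + t ≤ a ⊕ t
    ≤-⊕ a {t} 0≤t = +-monoʳ-≤ a (begin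
      t      ≡⟨ *-identityʳ t ⟨
      t * 1ℤ ≤⟨ *-monoˡ-≤-nonNeg t {{ℤ.nonNegative 0≤t}} (i<j⇒suc[i]≤j 0<N) ⟩
      t * N  ∎)
      where open ≤-Reasoning

    ⊕-monoʳ-< : ∀ a {s t} → s < t → a ⊕ s < a ⊕ t
    ⊕-monoʳ-< a s<t = +-monoʳ-< a (*-monoʳ-<-pos N s<t)

    ⊕-monoʳ-≤ : ∀ a {s t} → s ≤ t → a ⊕ s ≤ a ⊕ t
    ⊕-monoʳ-≤ a s≤t = +-monoʳ-≤ a (*-monoʳ-≤-nonNeg N s≤t)

    ⊕-monoˡ-< : ∀ t {a b} → a < b → a ⊕ t < b ⊕ t
    ⊕-monoˡ-< t = +-monoˡ-< (t * N)

    ⊕-monoˡ-≤ : ∀ t {a b} → a ≤ b → a ⊕ t ≤ b ⊕ t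
    ⊕-monoˡ-≤ t = +-monoˡ-≤ (t * N)

    ⊕-difference : ∀ a t → a ⊕ t - a ≡ t * N
    ⊕-difference a t = lemma a t N
      where
      lemma : ∀ a t N → a + t * N - a ≡ t * N
      lemma = solve-∀

    difference-⊕ : ∀ {a b t} → b - a ≡ t * N → b ≡ a ⊕ t
    difference-⊕ {a} {b} {t} eq = trans (lemma a b) (cong (λ d → a + d) eq)
      where
      lemma : ∀ a b → b ≡ a + (b - a)
      lemma = solve-∀

    ⊕-minus-⊕ : ∀ a b s t → a ⊕ s - (b ⊕ t) ≡ (a - b) ⊕ (s - t)
    ⊕-minus-⊕ a b s t = lemma a b s t N
      where
      lemma : ∀ a b s t N → a + s * N - (b + t * N) ≡ a - b + (s - t) * N
      lemma = solve-∀

  ⊕-comm : ∀ a s t → a ⊕ s ⊕ t ≡ a ⊕ t ⊕ s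
  ⊕-comm a s t = trans (⊕-assoc a s t) (trans (cong (a ⊕_) (+-comm s t)) (sym (⊕-assoc a t s)))

  ⊕-inverseʳ : ∀ a t → a ⊕ t ⊕ (- t) ≡ a
  ⊕-inverseʳ a t = trans (⊕-assoc a t (- t)) (trans (cong (a ⊕_) (+-inverseʳ t)) (⊕-identityʳ a))

  ⊕-inverseˡ : ∀ a t → a ⊕ (- t) ⊕ t ≡ a
  ⊕-inverseˡ a t = trans (⊕-assoc a (- t) t) (trans (cong (a ⊕_) (+-inverseˡ t)) (⊕-identityʳ a))

  ⊕-cancelʳ-< : ∀ a {s t} → a ⊕ s < a ⊕ t → s < t
  ⊕-cancelʳ-< a {s} {t} p with s <? t
  ... | yes s<t = s<t
  ... | no s≮t = contradiction p (≤⇒≯ (⊕-monoʳ-≤ a (≮⇒≥ s≮t)))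

  ⊕-cancelʳ-≤ : ∀ a {s t} → a ⊕ s ≤ a ⊕ t → s ≤ t
  ⊕-cancelʳ-≤ a {s} {t} p with s ≤? t
  ... | yes s≤t = s≤t
  ... | no s≰t = contradiction p (<⇒≱ (⊕-monoʳ-< a (≰⇒> s≰t)))

  <-⊕ : ∀ a {t} → 0ℤ < t → a < a ⊕ t
  <-⊕ a {t} 0<t = subst (_< a ⊕ t) (⊕-identityʳ a) (⊕-monoʳ-< a 0<t)

  ⊕-< : ∀ a {t} → t < 0ℤ → a ⊕ t < a
  ⊕-< a {t} t<0 = subst (a ⊕ t <_) (⊕-identityʳ a) (⊕-monoʳ-< a t<0)

  <-⊕⁻¹ : ∀ a {t} → a < a ⊕ t → 0ℤ < t
  <-⊕⁻¹ a {t} p = ⊕-cancelʳ-< a (subst (_< a ⊕ t) (sym (⊕-identityʳ a)) p)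

  ⊕-<⁻¹ : ∀ a {t} → a ⊕ t < a → t < 0ℤ
  ⊕-<⁻¹ a {t} p = ⊕-cancelʳ-< a (subst (a ⊕ t <_) (sym (⊕-identityʳ a)) p)

  infix 4 _≋_ _≋?_
  data _≋_ (a : ℤ) : ℤ → Set where
    ≋-⊕ : ∀ t → a ≋ a ⊕ t

  ≋-refl : ∀ {a} → a ≋ a
  ≋-refl {a} = subst (a ≋_) (⊕-identityʳ a) (≋-⊕ 0ℤ)

  ≋-reflexive : ∀ {a b} → a ≡ b → a ≋ b
  ≋-reflexive refl = ≋-refl

  ≋-sym : ∀ {a b} → a ≋ b → b ≋ a
  ≋-sym {a} (≋-⊕ t) = subst (a ⊕ t ≋_) (⊕-inverseʳ a t) (≋-⊕ (- t))

  ≋-trans : ∀ {a b c} → a ≋ b → b ≋ c → a ≋ c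
  ≋-trans {a} (≋-⊕ s) (≋-⊕ t) = subst (a ≋_) (sym (⊕-assoc a s t)) (≋-⊕ (s + t))

  ≋-⊕ʳ : ∀ {a b} t → a ≋ b → a ≋ b ⊕ t
  ≋-⊕ʳ t a≋b = ≋-trans a≋b (≋-⊕ t)

  ⊕-transpose : ∀ {a b s t} → a ⊕ s ≡ b ⊕ t → b ≡ a ⊕ (s - t)
  ⊕-transpose {a} {b} {s} {t} eq = begin
    b             ≡⟨ ⊕-inverseʳ b t ⟨
    b ⊕ t ⊕ (- t) ≡⟨ cong (_⊕ (- t)) eq ⟨
    a ⊕ s ⊕ (- t) ≡⟨ ⊕-assoc a s (- t) ⟩
    a ⊕ (s - t)   ∎
    where open ≡-Reasoning

  ≋-window : ∀ {u p q} → p ≋ q → u ≤ p → p < u ⊕ 1ℤ → u ≤ q → q < u ⊕ 1ℤ → p ≡ q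
  ≋-window {u} {p} (≋-⊕ t) u≤p p<u₁ u≤q q<u₁ with <-cmp t 0ℤ
  ... | tri≈ _ t≡0 _ = sym (trans (cong (p ⊕_) t≡0) (⊕-identityʳ p))
  ... | tri< t<0 _ _ = contradiction u≤q (<⇒≱ (begin-strict
    p ⊕ t          ≤⟨ ⊕-monoʳ-≤ p (i<j⇒i≤pred[j] t<0) ⟩
    p ⊕ (- 1ℤ)     <⟨ ⊕-monoˡ-< (- 1ℤ) p<u₁ ⟩
    u ⊕ 1ℤ ⊕ (- 1ℤ) ≡⟨ ⊕-inverseʳ u 1ℤ ⟩
    u              ∎))
    where open ≤-Reasoning
  ... | tri> _ _ 0<t = contradiction q<u₁ (≤⇒≯ (begin
    u ⊕ 1ℤ ≤⟨ ⊕-monoˡ-≤ 1ℤ u≤p ⟩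
    p ⊕ 1ℤ ≤⟨ ⊕-monoʳ-≤ p (i<j⇒suc[i]≤j 0<t) ⟩
    p ⊕ t  ∎))
    where open ≤-Reasoning

  ⊕-beyond : ∀ {a b} → a < b → Σ ℤ λ t → 0ℤ < t × b < a ⊕ t
  ⊕-beyond {a} {b} a<b = d , 0<d , (begin-strict
    b               <⟨ suc[i]≤j⇒i<j ≤-refl ⟩
    1ℤ + b          ≡⟨ lemma a b ⟩
    a + d           ≤⟨ ≤-⊕ a (<⇒≤ 0<d) ⟩
    a ⊕ d           ∎)
    where
    open ≤-Reasoning
    d : ℤ
    d = 1ℤ + (b - a)
    0<d : 0ℤ < d
    0<d = suc[i]≤j⇒i<j (+-monoʳ-≤ 1ℤ (i≤j⇒0≤j-i (<⇒≤ a<b)))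
    lemma : ∀ a b → 1ℤ + b ≡ a + (1ℤ + (b - a))
    lemma = solve-∀

  residue : ℤ → ℕ
  residue a = a %ℕ n

  residue<n : ∀ a → residue a ℕ.< n
  residue<n a = n%ℕd<d a n

  opaque
    unfolding _⊕_
    residue+quotient : ∀ a → a ≡ + residue a ⊕ (a /ℕ n)
    residue+quotient a = a≡a%ℕn+[a/ℕn]*n a n

  private
    quotient-≤ : ∀ {r r' q q'} → r' ℕ.< n → + r ⊕ q ≡ + r' ⊕ q' → q ≤ q'
    quotient-≤ {r} {r'} {q} {q'} r'<n eq with q ≤? q'
    ... | yes q≤q' = q≤q'
    ... | no q≰q' = contradiction (+<+ r'<n) (≤⇒≯ (begin
      N                ≤⟨ i≤j⇒i≤k+j (+ r) ≤-refl ⟩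
      + r + N          ≡⟨ ⊕-1 (+ r) ⟨
      + r ⊕ 1ℤ         ≤⟨ ⊕-monoʳ-≤ (+ r) (i<j⇒suc[i]≤j (i<j⇒0<j-i (≰⇒> q≰q'))) ⟩
      + r ⊕ (q - q')   ≡⟨ ⊕-transpose eq ⟨
      + r'             ∎))
      where
      open ≤-Reasoning

  divmod-unique : ∀ {r r' q q'} → r ℕ.< n → r' ℕ.< n → + r ⊕ q ≡ + r' ⊕ q' → r ≡ r' × q ≡ q'
  divmod-unique {r} {r'} {q} {q'} r<n r'<n eq = +-injective r≡r' , q≡q'
    where
    q≡q' : q ≡ q'
    q≡q' = ≤-antisym (quotient-≤ r'<n eq) (quotient-≤ r<n (sym eq))
    r≡r' : + r ≡ + r'
    r≡r' = begin
      + r            ≡⟨ ⊕-identityʳ (+ r) ⟨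
      + r ⊕ 0ℤ       ≡⟨ cong (+ r ⊕_) (+-inverseʳ q') ⟨
      + r ⊕ (q' - q') ≡⟨ cong (λ s → + r ⊕ (s - q')) q≡q' ⟨
      + r ⊕ (q - q') ≡⟨ ⊕-transpose eq ⟨
      + r'           ∎
      where open ≡-Reasoning

  divmod-⊕ : ∀ a t → residue (a ⊕ t) ≡ residue a × (a ⊕ t) /ℕ n ≡ a /ℕ n + t
  divmod-⊕ a t = divmod-unique (residue<n (a ⊕ t)) (residue<n a) (begin
    + residue (a ⊕ t) ⊕ ((a ⊕ t) /ℕ n) ≡⟨ residue+quotient (a ⊕ t) ⟨
    a ⊕ t                              ≡⟨ cong (_⊕ t) (residue+quotient a) ⟩
    + residue a ⊕ (a /ℕ n) ⊕ t         ≡⟨ ⊕-assoc (+ residue a) (a /ℕ n) t ⟩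
    + residue a ⊕ (a /ℕ n + t)         ∎)
    where open ≡-Reasoning

  ≋⇒residue≡ : ∀ {a b} → a ≋ b → residue a ≡ residue b
  ≋⇒residue≡ {a} (≋-⊕ t) = sym (proj₁ (divmod-⊕ a t))

  residue≡⇒≋ : ∀ {a b} → residue a ≡ residue b → a ≋ b
  residue≡⇒≋ {a} {b} eq = ≋-trans (≋-sym (residue-≋ a)) (subst (λ r → + r ≋ b) (sym eq) (residue-≋ b))
    where
    residue-≋ : ∀ a → + residue a ≋ a
    residue-≋ a = subst (+ residue a ≋_) (sym (residue+quotient a)) (≋-⊕ (a /ℕ n))

  _≋?_ : ∀ a b → Dec (a ≋ b)
  a ≋? b = map′ residue≡⇒≋ ≋⇒residue≡ (residue a ℕ.≟ residue b)

  private
    offset-split : ∀ a x {r} q → x - a ≡ + r ⊕ q → x ≡ a ⊕ q + + r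
    offset-split a x {r} q eq = begin
      x             ≡⟨ lemma₁ x a ⟩
      a + (x - a)   ≡⟨ cong (λ d → a + d) eq ⟩
      a + (+ r ⊕ q) ≡⟨ +-⊕-assoc a (+ r) q ⟨
      a + + r ⊕ q   ≡⟨ ⊕-+-comm a (+ r) q ⟩
      a ⊕ q + + r   ∎
      where
      open ≡-Reasoning
      lemma₁ : ∀ x a → x ≡ a + (x - a)
      lemma₁ = solve-∀

  between-periods : ∀ {a x} → ¬ a ≋ x → Σ ℤ λ t → a ⊕ t < x × x < a ⊕ t ⊕ 1ℤ
  between-periods {a} {x} a≉x with residue (x - a) | residue<n (x - a) | residue+quotient (x - a)
  ... | ℕ.zero  | _   | eq = contradiction (subst (a ≋_) (sym (trans (offset-split a x _ eq) (+-identityʳ _))) (≋-⊕ _)) a≉x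
  ... | ℕ.suc r | r<n | eq = q , a⊕q<x , x<a⊕q⊕1
    where
    q : ℤ
    q = (x - a) /ℕ n
    open ≤-Reasoning
    a⊕q<x : a ⊕ q < x
    a⊕q<x = begin-strict
      a ⊕ q            ≡⟨ +-identityʳ (a ⊕ q) ⟨
      a ⊕ q + 0ℤ       <⟨ +-monoʳ-< (a ⊕ q) (+<+ ℕ.z<s) ⟩
      a ⊕ q + +[1+ r ] ≡⟨ offset-split a x q eq ⟨
      x                ∎
    x<a⊕q⊕1 : x < a ⊕ q ⊕ 1ℤ
    x<a⊕q⊕1 = begin-strict
      x                ≡⟨ offset-split a x q eq ⟩
      a ⊕ q + +[1+ r ] <⟨ +-monoʳ-< (a ⊕ q) (+<+ r<n) ⟩
      a ⊕ q + N        ≡⟨ ⊕-1 (a ⊕ q) ⟨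
      a ⊕ q ⊕ 1ℤ       ∎

  ≋⇒∣ : ∀ {a b} → a ≋ b → + n ∣ b - a
  ≋⇒∣ {a} (≋-⊕ t) = ∣⇒∣ᵤ (divides t (⊕-difference a t))

  ∣⇒≋ : ∀ {a b} → + n ∣ b - a → a ≋ b
  ∣⇒≋ {a} n∣b-a with ∣ᵤ⇒∣ n∣b-a
  ... | divides t eq = subst (a ≋_) (sym (difference-⊕ eq)) (≋-⊕ t)

  IsRoot : ℤ → ℤ → Set
  IsRoot a b = a < b × ¬ a ≋ b

  window-≉ : ∀ {u x} → u < x → x < u ⊕ 1ℤ → ¬ u ≋ x
  window-≉ {u} u<x x<u₁ u≋x = <-irrefl (≋-window u≋x ≤-refl (<-⊕ u (+<+ ℕ.z<s)) (<⇒≤ u<x) x<u₁) u<x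

  ≋-<⇒⊕1≤ : ∀ {a b} → a ≋ b → a < b → a ⊕ 1ℤ ≤ b
  ≋-<⇒⊕1≤ {a} (≋-⊕ t) a<b = ⊕-monoʳ-≤ a (i<j⇒suc[i]≤j (<-⊕⁻¹ a a<b))

module Reachability (n : ℕ) .{{_ : NonZero n}} where

  open Congruence n

  module Over (S : ℤ → ℤ → Set)
              (S⇒IsRoot : ∀ {a b} → S a b → IsRoot a b)
              (S-shift : ∀ {a b} t → S a b → S (a ⊕ t) (b ⊕ t))
              (S-cosplit : ∀ {a b c} → S a c → a < b → b < c → ¬ a ≋ b → ¬ b ≋ c → ¬ S a b → ¬ S b c → ⊥)
              (S-cowrap : ∀ {a b x} → S a b → x ≋ b → a < x → x < b → ¬ S a x →
                          ∀ {b' a'} → b ≋ b' → a ≋ a' → b' < a' → ¬ S b' a' → ⊥)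
              where

    S-< : ∀ {a b} → S a b → a < b
    S-< = proj₁ ∘ S⇒IsRoot

    S-cowrapˡ : ∀ {a b x} → S a b → a ≋ x → a < x → x < b → ¬ S x b →
                ∀ {b' a'} → b ≋ b' → a ≋ a' → b' < a' → ¬ S b' a' → ⊥
    S-cowrapˡ {a} {b} s (≋-⊕ t) a<x x<b ¬Sxb =
      S-cowrap s (≋-sym (≋-⊕ (- t))) a<x' x'<b ¬Sax'
      where
      x' : ℤ
      x' = b ⊕ (- t)
      a<x' : a < x'
      a<x' = subst (_< x') (⊕-inverseʳ a t) (⊕-monoˡ-< (- t) x<b)
      x'<b : x' < b
      x'<b = subst (x' <_) (⊕-inverseˡ b t) (<-⊕ x' (<-⊕⁻¹ a a<x))
      ¬Sax' : ¬ S a x'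
      ¬Sax' s' = ¬Sxb (subst (S (a ⊕ t)) (⊕-inverseˡ b t) (S-shift t s'))

    Chain : ℤ → ℤ → Set
    Chain = TransClosure S

    Chain-< : ∀ {a b} → Chain a b → a < b
    Chain-< [ s ] = S-< s
    Chain-< (s ∷ p) = <-trans (S-< s) (Chain-< p)

    Chain-shift : ∀ {a b} t → Chain a b → Chain (a ⊕ t) (b ⊕ t)
    Chain-shift t [ s ] = [ S-shift t s ]
    Chain-shift t (s ∷ p) = S-shift t s ∷ Chain-shift t p

    Star-≤ : ∀ {a b} → Star S a b → a ≤ b
    Star-≤ ε = ≤-refl
    Star-≤ (s ◅ p) = <⇒≤ (<-≤-trans (S-< s) (Star-≤ p))

    _◅⁺_ : ∀ {a b c} → S a b → Star S b c → Chain a c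
    s ◅⁺ ε = [ s ]
    s ◅⁺ (t ◅ p) = s ∷ (t ◅⁺ p)

    _▻⁺_ : ∀ {a b c} → Star S a b → S b c → Chain a c
    ε ▻⁺ s = [ s ]
    (t ◅ p) ▻⁺ s = t ∷ (p ▻⁺ s)

    Star⇒Chain : ∀ {a b} → Star S a b → ¬ a ≋ b → Chain a b
    Star⇒Chain ε a≉a = contradiction ≋-refl a≉a
    Star⇒Chain (s ◅ p) _ = s ◅⁺ p

    Loop : ℤ → Set
    Loop a = Σ ℤ λ d → 0ℤ < d × Chain a (a ⊕ d)

    Loop-shift : ∀ {a} t → Loop a → Loop (a ⊕ t)
    Loop-shift {a} t (d , 0<d , p) = d , 0<d , subst (Chain (a ⊕ t)) (⊕-comm a d t) (Chain-shift t p)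

    Loop-≋ : ∀ {a b} → a ≋ b → Loop a → Loop b
    Loop-≋ (≋-⊕ t) = Loop-shift t

    data Step : ℤ → ℤ → Set where
      edge : ∀ {a b} → S a b → Step a b
      wind : ∀ {a} → Loop a → ∀ {c} → 0ℤ < c → Step a (a ⊕ c)

    Reach : ℤ → ℤ → Set
    Reach = TransClosure Step

    Step-< : ∀ {a b} → Step a b → a < b
    Step-< (edge s) = S-< s
    Step-< (wind {a} _ 0<c) = <-⊕ a 0<c

    Reach-< : ∀ {a b} → Reach a b → a < b
    Reach-< [ s ] = Step-< s
    Reach-< (s ∷ p) = <-trans (Step-< s) (Reach-< p)

    Step-shift : ∀ {a b} t → Step a b → Step (a ⊕ t) (b ⊕ t)
    Step-shift t (edge s) = edge (S-shift t s)
    Step-shift t (wind {a} l {c} 0<c) = subst (Step (a ⊕ t)) (⊕-comm a t c) (wind (Loop-shift t l) 0<c)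

    Reach-shift : ∀ {a b} t → Reach a b → Reach (a ⊕ t) (b ⊕ t)
    Reach-shift t [ s ] = [ Step-shift t s ]
    Reach-shift t (s ∷ p) = Step-shift t s ∷ Reach-shift t p

    S⇒Reach : ∀ {a b} → S a b → Reach a b
    S⇒Reach s = [ edge s ]

    Loop⇒Reach : ∀ {a b} → Loop a → a ≋ b → a < b → Reach a b
    Loop⇒Reach {a} l (≋-⊕ t) a<b = [ wind l (<-⊕⁻¹ a a<b) ]

    cosplit-edge : ∀ {a b x} → S a b → a < x → x < b → ¬ Reach a x → ¬ Reach x b → ⊥
    cosplit-edge {a} {b} {x} s a<x x<b ¬a⇝x ¬x⇝b with ⊕-beyond (S-< s) | a ≋? x | x ≋? b
    ... | d , 0<d , b<a⊕d | yes a≋x | _ =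
      S-cowrapˡ s a≋x a<x x<b (¬x⇝b ∘ S⇒Reach) ≋-refl (≋-⊕ d) b<a⊕d
        (λ s' → ¬a⇝x (Loop⇒Reach (d , 0<d , s ∷ [ s' ]) a≋x a<x))
    ... | d , 0<d , b<a⊕d | no _ | yes x≋b =
      S-cowrap s x≋b a<x x<b (¬a⇝x ∘ S⇒Reach) ≋-refl (≋-⊕ d) b<a⊕d
        (λ s' → ¬x⇝b (Loop⇒Reach (Loop-≋ (≋-sym x≋b) (d , 0<d , s' ∷ [ S-shift d s ])) x≋b x<b))
    ... | _ | no a≉x | no x≉b = S-cosplit s a<x x<b a≉x x≉b (¬a⇝x ∘ S⇒Reach) (¬x⇝b ∘ S⇒Reach)

    module _ {R : ℤ → ℤ → Set} (R⇒Reach : ∀ {a b} → R a b → Reach a b) where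

      R⁺⇒Reach : ∀ {a b} → TransClosure R a b → Reach a b
      R⁺⇒Reach [ r ] = R⇒Reach r
      R⁺⇒Reach (r ∷ p) = R⇒Reach r ++ R⁺⇒Reach p

      cosplit-closure : (∀ {a c x} → R a c → a < x → x < c → ¬ Reach a x → ¬ Reach x c → ⊥) →
                        ∀ {a c x} → TransClosure R a c → a < x → x < c → ¬ Reach a x → ¬ Reach x c → ⊥
      cosplit-closure R-cosplit [ r ] = R-cosplit r
      cosplit-closure R-cosplit {x = x} (_∷_ {y = m} r p) a<x x<c ¬a⇝x ¬x⇝c with <-cmp x m
      ... | tri< x<m _ _ = R-cosplit r a<x x<m ¬a⇝x (λ x⇝m → ¬x⇝c (x⇝m ++ R⁺⇒Reach p))
      ... | tri≈ _ refl _ = ¬a⇝x (R⇒Reach r)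
      ... | tri> _ _ m<x = cosplit-closure R-cosplit p m<x x<c (λ m⇝x → ¬a⇝x (R⇒Reach r ++ m⇝x)) ¬x⇝c

    Chain⇒Reach : ∀ {a b} → Chain a b → Reach a b
    Chain⇒Reach = R⁺⇒Reach S⇒Reach

    cosplit-chain : ∀ {a c x} → Chain a c → a < x → x < c → ¬ Reach a x → ¬ Reach x c → ⊥
    cosplit-chain = cosplit-closure S⇒Reach cosplit-edge

    Gap : ℤ → ℤ → ℤ → Set
    Gap a b x = Σ ℤ λ a' → Σ ℤ λ b' → Star S a a' × S a' b' × Star S b' b × a' < x × x < b'

    locate : ∀ {a b x} → Chain a b → a < x → x < b → Chain a x × Chain x b ⊎ Gap a b x
    locate {a} {b} [ s ] a<x x<b = inj₂ (a , b , ε , s , ε , a<x , x<b)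
    locate {a} {x = x} (_∷_ {y = m} s p) a<x x<b with <-cmp x m
    ... | tri< x<m _ _ = inj₂ (a , m , ε , s , Chain⇒Star p , a<x , x<m)
      where
      Chain⇒Star : ∀ {a b} → Chain a b → Star S a b
      Chain⇒Star [ s ] = s ◅ ε
      Chain⇒Star (s ∷ p) = s ◅ Chain⇒Star p
    ... | tri≈ _ refl _ = inj₁ ([ s ] , p)
    ... | tri> _ _ m<x with locate p m<x x<b
    ...   | inj₁ (p₁ , p₂) = inj₁ (s ∷ p₁ , p₂)
    ...   | inj₂ (a' , b' , pa , s' , pb , l , r) = inj₂ (a' , b' , s ◅ pa , s' , pb , l , r)

    Window : ℕ → Set
    Window k = ∀ {u x} → Chain u (u ⊕ +[1+ k ]) → u < x → x < u ⊕ 1ℤ → ¬ Reach u x → ¬ Reach x (u ⊕ 1ℤ) → ⊥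

    -- Look at the edge of the cycle that jumps over u ⊕ 1:
    -- either it starts at u, or it ends in the class of u (before the end of the cycle, this closes a shorter
    -- cycle), or coclosedness of S splits it at u ⊕ 1, which again closes a shorter cycle.
    private
      module WindowStep (k : ℕ) (shorter : ∀ {j} → j ℕ.< ℕ.suc k → Window j)
                        {u x : ℤ} (loop : Chain u (u ⊕ +[1+ ℕ.suc k ]))
                        (u<x : u < x) (x<u₁ : x < u ⊕ 1ℤ) (¬u⇝x : ¬ Reach u x) (¬x⇝u₁ : ¬ Reach x (u ⊕ 1ℤ)) where

        u₁ d : ℤ
        u₁ = u ⊕ 1ℤ
        d = +[1+ ℕ.suc k ]

        u<u₁ : u < u₁
        u<u₁ = <-⊕ u (+<+ ℕ.z<s)

        u₁<u⊕d : u₁ < u ⊕ d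
        u₁<u⊕d = ⊕-monoʳ-< u (+<+ (ℕ.s≤s (ℕ.s≤s ℕ.z≤n)))

        u≋u₁ : u ≋ u₁
        u≋u₁ = ≋-⊕ 1ℤ

        u≉x : ¬ u ≋ x
        u≉x = window-≉ u<x x<u₁

        x≉u₁ : ¬ x ≋ u₁
        x≉u₁ x≋u₁ = u≉x (≋-trans u≋u₁ (≋-sym x≋u₁))

        ¬Sux : ¬ S u x
        ¬Sux = ¬u⇝x ∘ S⇒Reach

        ¬Sxu₁ : ¬ S x u₁
        ¬Sxu₁ = ¬x⇝u₁ ∘ S⇒Reach

        no-shorter-loop : ∀ {j} → j ℕ.< ℕ.suc k → ¬ Chain u (u ⊕ +[1+ j ])
        no-shorter-loop j<k p = shorter j<k p u<x x<u₁ ¬u⇝x ¬x⇝u₁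

        ¬u↝u₁ : ¬ Chain u u₁
        ¬u↝u₁ = no-shorter-loop (ℕ.s≤s ℕ.z≤n)

        ¬u₁↝u⊕d : ¬ Chain u₁ (u ⊕ d)
        ¬u₁↝u⊕d p = no-shorter-loop ℕ.≤-refl (subst₂ Chain (⊕-inverseʳ u 1ℤ) (⊕-assoc u d (- 1ℤ)) (Chain-shift (- 1ℤ) p))

        no-edge-to-period : ∀ {v} → u ≋ v → u₁ ≤ v → ¬ S x v
        no-edge-to-period {v} u≋v u₁≤v sxv with ≤⇒≡⊎< u₁≤v
        ... | inj₁ refl = ¬Sxu₁ sxv
        ... | inj₂ u₁<v = S-cowrap sxv (≋-trans (≋-sym u≋u₁) u≋v) x<u₁ u₁<v ¬Sxu₁ (≋-sym u≋v) ≋-refl u<x ¬Sux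

        edge-from-u : ∀ {b} → S u b → u₁ < b → ¬ S u₁ b → ⊥
        edge-from-u {b} s u₁<b ¬Su₁b with x ≋? b
        ... | yes x≋b = S-cowrapˡ s u≋u₁ u<u₁ u₁<b ¬Su₁b (≋-sym x≋b) u≋u₁ x<u₁ ¬Sxu₁
        ... | no x≉b = S-cosplit s u<x (<-trans x<u₁ u₁<b) u≉x x≉b ¬Sux
                        (λ sxb → S-cosplit sxb x<u₁ u₁<b x≉u₁ (proj₂ (S⇒IsRoot s) ∘ ≋-trans u≋u₁) ¬Sxu₁ ¬Su₁b)

        edge-into-end : ∀ {a} → Chain u a → S a (u ⊕ d) → a < u₁ → ⊥
        edge-into-end {a} p s a<u₁ with x ≋? a | <-cmp a x
        ... | yes x≋a | _ = ¬u⇝x (subst (Reach u) (sym (≋-window x≋a (<⇒≤ u<x) x<u₁ (<⇒≤ (Chain-< p)) a<u₁)) (Chain⇒Reach p))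
        ... | no x≉a | tri≈ _ a≡x _ = x≉a (≋-reflexive (sym a≡x))
        ... | no x≉a | tri< a<x _ _ =
          S-cosplit s a<x (<-trans x<u₁ u₁<u⊕d) (x≉a ∘ ≋-sym) (u≉x ∘ ≋-trans (≋-⊕ d) ∘ ≋-sym)
            (λ sax → ¬u⇝x (Chain⇒Reach (p ++ [ sax ])))
            (no-edge-to-period (≋-⊕ d) (<⇒≤ u₁<u⊕d))
        ... | no x≉a | tri> _ _ x<a =
          S-cosplit (S-shift (- 1ℤ) s) (<-trans a⁻<u u<x) (<-≤-trans x<u₁ u₁≤v) a⁻≉x x≉v ¬Sa⁻x (no-edge-to-period u≋v u₁≤v)
          where
          a⁻ v : ℤ
          a⁻ = a ⊕ (- 1ℤ)
          v = u ⊕ d ⊕ (- 1ℤ)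
          a⁻<u : a⁻ < u
          a⁻<u = subst (a⁻ <_) (⊕-inverseʳ u 1ℤ) (⊕-monoˡ-< (- 1ℤ) a<u₁)
          u₁≤v : u₁ ≤ v
          u₁≤v = subst (u₁ ≤_) (sym (⊕-assoc u d (- 1ℤ))) (⊕-monoʳ-≤ u (+≤+ (ℕ.s≤s ℕ.z≤n)))
          u≋v : u ≋ v
          u≋v = ≋-⊕ʳ (- 1ℤ) (≋-⊕ d)
          a≋a⁻ : a ≋ a⁻
          a≋a⁻ = ≋-⊕ (- 1ℤ)
          a⁻≉x : ¬ a⁻ ≋ x
          a⁻≉x a⁻≋x = x≉a (≋-sym (≋-trans a≋a⁻ a⁻≋x))
          x≉v : ¬ x ≋ v
          x≉v x≋v = u≉x (≋-sym (≋-trans x≋v (≋-sym u≋v)))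
          u≉a : ¬ u ≋ a
          u≉a = window-≉ (Chain-< p) a<u₁
          ¬Sa⁻u : ¬ S a⁻ u
          ¬Sa⁻u s' = ¬u↝u₁ (p ++ [ subst (λ b → S b u₁) (⊕-inverseˡ a 1ℤ) (S-shift 1ℤ s') ])
          ¬Sa⁻x : ¬ S a⁻ x
          ¬Sa⁻x s' = S-cosplit s' a⁻<u u<x (λ a⁻≋u → u≉a (≋-sym (≋-trans a≋a⁻ a⁻≋u))) u≉x ¬Sa⁻u ¬Sux

        edge-to-period : ∀ {a t} → Star S u a → ¬ u ≋ a → S a (u ⊕ t) → Star S (u ⊕ t) (u ⊕ d) →
                         a < u₁ → u₁ < u ⊕ t → ⊥
        edge-to-period {a} {t} pa u≉a s pb a<u₁ u₁<u⊕t with <-cmp t d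
        ... | tri≈ _ refl _ = edge-into-end (Star⇒Chain pa u≉a) s a<u₁
        ... | tri> _ _ d<t = <⇒≱ d<t (⊕-cancelʳ-≤ u (Star-≤ pb))
        ... | tri< t<d _ _ with t | <-⊕⁻¹ u (<-trans u<u₁ u₁<u⊕t)
        ...   | +0 | +<+ ()
        ...   | +[1+ j ] | _ = no-shorter-loop (ℕ.s<s⁻¹ (drop‿+<+ t<d)) (Star⇒Chain pa u≉a ++ [ s ])

        absurd : ⊥
        absurd with locate loop u<u₁ u₁<u⊕d
        ... | inj₁ (p , _) = ¬u↝u₁ p
        ... | inj₂ (a' , b' , pa , s , pb , a'<u₁ , u₁<b') with u ≋? a' | u ≋? b'
        ...   | yes u≋a' | _ =
          edge-from-u (subst (λ a → S a b') (sym (≋-window u≋a' ≤-refl u<u₁ (Star-≤ pa) a'<u₁)) s) u₁<b'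
            (λ s' → ¬u₁↝u⊕d (s' ◅⁺ pb))
        ...   | no u≉a' | no u≉b' =
          S-cosplit s a'<u₁ u₁<b' (λ a'≋u₁ → u≉a' (≋-trans u≋u₁ (≋-sym a'≋u₁))) (u≉b' ∘ ≋-trans u≋u₁)
            (λ s' → ¬u↝u₁ (pa ▻⁺ s')) (λ s' → ¬u₁↝u⊕d (s' ◅⁺ pb))
        ...   | no u≉a' | yes (≋-⊕ t) = edge-to-period pa u≉a' s pb a'<u₁ u₁<b'

    window : ∀ k → Window k
    window = <-rec Window step
      where
      step : ∀ k → (∀ {j} → j ℕ.< k → Window j) → Window k
      step ℕ.zero _ = cosplit-chain
      step (ℕ.suc k) shorter loop u<x x<u₁ ¬u⇝x ¬x⇝u₁ = WindowStep.absurd k shorter loop u<x x<u₁ ¬u⇝x ¬x⇝u₁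

    Loop-window : ∀ {u x} → Loop u → u < x → x < u ⊕ 1ℤ → ¬ Reach u x → ¬ Reach x (u ⊕ 1ℤ) → ⊥
    Loop-window (+[1+ k ] , _ , p) = window k p
    Loop-window (+0 , +<+ () , _)

    Loop-prepend : ∀ {a b y} → Loop a → a ≋ b → a ≤ b → Reach b y → Reach a y
    Loop-prepend l a≋b a≤b p with ≤⇒≡⊎< a≤b
    ... | inj₁ refl = p
    ... | inj₂ a<b = Loop⇒Reach l a≋b a<b ++ p

    Loop-append : ∀ {a b y} → Loop a → a ≋ b → a ≤ b → Reach y a → Reach y b
    Loop-append l a≋b a≤b p with ≤⇒≡⊎< a≤b
    ... | inj₁ refl = p
    ... | inj₂ a<b = p ++ Loop⇒Reach l a≋b a<b

    cosplit-wind : ∀ {a c x} → Loop a → a ≋ c → a < x → x < c → ¬ Reach a x → ¬ Reach x c → ⊥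
    cosplit-wind {a} {c} {x} l a≋c a<x x<c ¬a⇝x ¬x⇝c with a ≋? x
    ... | yes a≋x = ¬a⇝x (Loop⇒Reach l a≋x a<x)
    ... | no a≉x with between-periods a≉x
    ...   | t , u<x , x<u₁ = Loop-window (Loop-shift t l) u<x x<u₁
                               (¬a⇝x ∘ Loop-prepend l (≋-⊕ t) a≤u)
                               (¬x⇝c ∘ Loop-append (Loop-shift 1ℤ (Loop-shift t l)) u₁≋c (≋-<⇒⊕1≤ u≋c (<-trans u<x x<c)))
      where
      u≋c : a ⊕ t ≋ c
      u≋c = ≋-trans (≋-sym (≋-⊕ t)) a≋c
      u₁≋c : a ⊕ t ⊕ 1ℤ ≋ c
      u₁≋c = ≋-trans (≋-sym (≋-⊕ 1ℤ)) u≋c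
      a≤u : a ≤ a ⊕ t
      a≤u = ≮⇒≥ (λ u<a → <⇒≱ (<-trans a<x x<u₁) (≋-<⇒⊕1≤ (≋-sym (≋-⊕ t)) u<a))

    Step-cosplit : ∀ {a c x} → Step a c → a < x → x < c → ¬ Reach a x → ¬ Reach x c → ⊥
    Step-cosplit (edge s) = cosplit-edge s
    Step-cosplit (wind l {c} _) = cosplit-wind l (≋-⊕ c)

    Reach-cosplit : ∀ {a c x} → Reach a c → a < x → x < c → ¬ Reach a x → ¬ Reach x c → ⊥
    Reach-cosplit = cosplit-closure [_] Step-cosplit

    Loop-power : ∀ {a} d → Chain a (a ⊕ d) → ∀ m → Chain a (a ⊕ +[1+ m ] * d)
    Loop-power {a} d p ℕ.zero = subst (λ e → Chain a (a ⊕ e)) (sym (*-identityˡ d)) p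
    Loop-power {a} d p (ℕ.suc m) = Loop-power d p m ++ subst (Chain _) eq (Chain-shift (+[1+ m ] * d) p)
      where
      eq : a ⊕ d ⊕ +[1+ m ] * d ≡ a ⊕ +[1+ ℕ.suc m ] * d
      eq = trans (⊕-assoc a d (+[1+ m ] * d)) (cong (a ⊕_) (lemma d +[1+ m ]))
        where
        lemma : ∀ d y → d + y * d ≡ (1ℤ + y) * d
        lemma = solve-∀

    Loop-beyond : ∀ {a} → Loop a → ∀ {c} → 0ℤ < c → Σ ℤ λ k → 0ℤ ≤ k × Chain a (a ⊕ c ⊕ k)
    Loop-beyond (+0 , +<+ () , _)
    Loop-beyond (d , _ , _) {+0} (+<+ ())
    Loop-beyond {a} (d , 0<d , p) {c@(+[1+ m ])} _ = c * d - c , 0≤k , subst (Chain a) eq (Loop-power d p m)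
      where
      0≤k : 0ℤ ≤ c * d - c
      0≤k = i≤j⇒0≤j-i (subst (_≤ c * d) (*-identityʳ c) (*-monoˡ-≤-nonNeg c (i<j⇒suc[i]≤j 0<d)))
      eq : a ⊕ c * d ≡ a ⊕ c ⊕ (c * d - c)
      eq = trans (cong (a ⊕_) (lemma c d)) (sym (⊕-assoc a c (c * d - c)))
        where
        lemma : ∀ c d → c * d ≡ c + (c * d - c)
        lemma = solve-∀

    Step⇒Chain : ∀ {a b} → Step a b → Σ ℤ λ k → 0ℤ ≤ k × Chain a (b ⊕ k)
    Step⇒Chain {a} {b} (edge s) = 0ℤ , ≤-refl , subst (Chain a) (sym (⊕-identityʳ b)) [ s ]
    Step⇒Chain (wind l 0<c) = Loop-beyond l 0<c

    Reach⇒Chain : ∀ {a b} → Reach a b → Σ ℤ λ k → 0ℤ ≤ k × Chain a (b ⊕ k)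
    Reach⇒Chain [ s ] = Step⇒Chain s
    Reach⇒Chain {b = c} (_∷_ {y = b} s p) with Step⇒Chain s | Reach⇒Chain p
    ... | k , 0≤k , q | l , 0≤l , r =
      l + k , +-mono-≤ 0≤l 0≤k , q ++ subst (Chain (b ⊕ k)) (⊕-assoc c l k) (Chain-shift k r)

    Reach-≋⇒Loop : ∀ {a b} → Reach a b → a ≋ b → Loop a
    Reach-≋⇒Loop {a} p (≋-⊕ t) with Reach⇒Chain p
    ... | k , 0≤k , q = t + k , +-mono-<-≤ (<-⊕⁻¹ a (Reach-< p)) 0≤k , subst (Chain a) (⊕-assoc a t k) q

    Reach-fan : ∀ {i k k₁ k₂} → Reach i k₁ → Reach i k₂ → k ≋ k₁ → k ≋ k₂ → k₁ < k → k < k₂ → ¬ ¬ Reach i k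
    Reach-fan i⇝k₁ i⇝k₂ k≋k₁ k≋k₂ k₁<k k<k₂ ¬i⇝k =
      Reach-cosplit i⇝k₂ (<-trans (Reach-< i⇝k₁) k₁<k) k<k₂ ¬i⇝k
        (λ k⇝k₂ → ¬i⇝k (i⇝k₁ ++ Loop⇒Reach (Loop-≋ k≋k₁ (Reach-≋⇒Loop k⇝k₂ k≋k₂)) (≋-sym k≋k₁) k₁<k))

    Reach-cofan : ∀ {i k k₁ k₂} → Reach i k → k ≋ k₁ → k ≋ k₂ → i < k₁ → k₁ < k → k < k₂ →
                  ¬ Reach i k₁ → ¬ Reach i k₂ → ⊥
    Reach-cofan {k = k} {k₁} i⇝k k≋k₁ k≋k₂ i<k₁ k₁<k k<k₂ ¬i⇝k₁ ¬i⇝k₂ =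
      Reach-cosplit i⇝k i<k₁ k₁<k ¬i⇝k₁
        (λ k₁⇝k → ¬i⇝k₂ (i⇝k ++ Loop⇒Reach (Loop-≋ k₁≋k (Reach-≋⇒Loop k₁⇝k k₁≋k)) k≋k₂ k<k₂))
      where
      k₁≋k : k₁ ≋ k
      k₁≋k = ≋-sym k≋k₁

    Reach-wrap : ∀ {i k k₁ k' i'} → Reach i k₁ → k ≋ k₁ → k₁ < k → k ≋ k' → i ≋ i' → Reach k' i' → Reach i k
    Reach-wrap {i} {k} {k₁} {k'} i⇝k₁ k≋k₁ k₁<k k≋k' (≋-⊕ a) k'⇝i' =
      i⇝k₁ ++ Loop⇒Reach (Loop-≋ (≋-trans (≋-sym k≋k') k≋k₁) loop-k') (≋-sym k≋k₁) k₁<k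
      where
      loop-k' : Loop k'
      loop-k' = Reach-≋⇒Loop (k'⇝i' ++ Reach-shift a i⇝k₁) (≋-⊕ʳ a (≋-trans (≋-sym k≋k') k≋k₁))

    Reach-cowrap : ∀ {i k k₁ k' i'} → Reach i k → k ≋ k₁ → i < k₁ → k₁ < k → ¬ Reach i k₁ →
                   k ≋ k' → i ≋ i' → k' < i' → ¬ Reach k' i' → ⊥
    Reach-cowrap {i} {k} {k₁} {k'} {i'} i⇝k k≋k₁ i<k₁ k₁<k ¬i⇝k₁ k≋k' i≋i' k'<i' ¬k'⇝i'
      with ≋-sym k≋k₁ | ≋-trans (≋-sym k≋k₁) k≋k'
    ... | ≋-⊕ s | ≋-⊕ b =
      Reach-cosplit i⁻⇝k₁ i⁻<i i<k₁ (no-loop ∘ Reach-≋⇒Loop′) ¬i⇝k₁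
      where
      i⁻ : ℤ
      i⁻ = i ⊕ (- s)
      i⁻⇝k₁ : Reach i⁻ k₁
      i⁻⇝k₁ = subst (Reach i⁻) (⊕-inverseʳ k₁ s) (Reach-shift (- s) i⇝k)
      i⁻<i : i⁻ < i
      i⁻<i = ⊕-< i (neg-mono-< (<-⊕⁻¹ k₁ k₁<k))
      Reach-≋⇒Loop′ : Reach i⁻ i → Loop i
      Reach-≋⇒Loop′ p = Loop-≋ (≋-sym (≋-⊕ (- s))) (Reach-≋⇒Loop p (≋-sym (≋-⊕ (- s))))
      no-loop : ¬ Loop i
      no-loop l = Reach-cosplit w⇝i' w<k' k'<i' ¬w⇝k' ¬k'⇝i'
        where
        w : ℤ
        w = i ⊕ b
        w<k' : w < k₁ ⊕ b
        w<k' = ⊕-monoˡ-< b i<k₁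
        w⇝i' : Reach w i'
        w⇝i' = Loop⇒Reach (Loop-shift b l) (≋-trans (≋-sym (≋-⊕ b)) i≋i') (<-trans w<k' k'<i')
        ¬w⇝k' : ¬ Reach w (k₁ ⊕ b)
        ¬w⇝k' p = ¬i⇝k₁ (subst₂ Reach (⊕-inverseʳ i b) (⊕-inverseʳ k₁ b) (Reach-shift (- b) p))

    module Minimal (R : ℤ → ℤ → Set)
                 (R⇒IsRoot : ∀ {a b} → R a b → IsRoot a b)
                 (S⇒R : ∀ {a b} → S a b → R a b)
                 (R-shift : ∀ {a b} t → R a b → R (a ⊕ t) (b ⊕ t))
                 (R-split : ∀ {i j k} → R i j → R j k → ¬ i ≋ k → R i k)
                 (R-fan : ∀ {i k k₁ k₂} → R i k₁ → R i k₂ → k ≋ k₁ → k ≋ k₂ → k₁ < k → k < k₂ → R i k)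
                 (R-wrap : ∀ {i k k₁ k' i'} → R i k₁ → k ≋ k₁ → k₁ < k → k ≋ k' → i ≋ i' → R k' i' → R i k)
                 where

      private
        R-< : ∀ {a b} → R a b → a < b
        R-< = proj₁ ∘ R⇒IsRoot

        R-≉ : ∀ {a b} → R a b → ¬ a ≋ b
        R-≉ = proj₂ ∘ R⇒IsRoot

      Cycle : ℤ → Set
      Cycle a = Σ ℤ λ y → Σ ℤ λ w → R a y × R y w × a ≋ w

      R-cycle-beyond : ∀ {u y w} → R u y → R y w → u ≋ w → ∀ {t} → 0ℤ < t → R y (w ⊕ t)
      R-cycle-beyond {u} {y} {w} u→y y→w u≋w {t} 0<t =
        R-wrap y→w (≋-sym (≋-⊕ t)) (<-⊕ w 0<t) (≋-sym (≋-⊕ʳ t u≋w)) ≋-refl u→y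

      private
        R-far-past-cycle : ∀ {i u y m} → R i u → R u y → R y (u ⊕ m) → ¬ i ≋ y → ∀ {e} → m + 1ℤ < e → R i (u ⊕ e)
        R-far-past-cycle {i} {u} {y} {m} i→u u→y y→w i≉y {e} m+1<e =
          subst (R i) eq (R-split i→y⊕1 (R-shift 1ℤ (R-cycle-beyond u→y y→w (≋-⊕ m) 0<t)) i≉)
          where
          t : ℤ
          t = e - (m + 1ℤ)
          0<t : 0ℤ < t
          0<t = subst (_< t) (+-inverseʳ (m + 1ℤ)) (+-monoˡ-< (- (m + 1ℤ)) m+1<e)
          i→y⊕1 : R i (y ⊕ 1ℤ)
          i→y⊕1 = R-split i→u (R-wrap u→y (≋-sym (≋-⊕ 1ℤ)) (<-⊕ y (+<+ ℕ.z<s)) (≋-sym (≋-⊕ 1ℤ)) (≋-⊕ m) y→w)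
                    (λ i≋y⊕1 → i≉y (≋-trans i≋y⊕1 (≋-sym (≋-⊕ 1ℤ))))
          eq : u ⊕ m ⊕ t ⊕ 1ℤ ≡ u ⊕ e
          eq = trans (⊕-assoc (u ⊕ m) t 1ℤ) (trans (⊕-assoc u m (t + 1ℤ)) (cong (u ⊕_) (lemma m e)))
            where
            lemma : ∀ m e → m + (e - (m + 1ℤ) + 1ℤ) ≡ e
            lemma = solve-∀
          i≉ : ¬ i ≋ u ⊕ m ⊕ t ⊕ 1ℤ
          i≉ i≋ = R-≉ i→u (≋-trans i≋ (≋-sym (≋-⊕ʳ 1ℤ (≋-⊕ʳ t (≋-⊕ m)))))

      R-past-cycle : ∀ {i u} → R i u → Cycle u → ∀ {c} → 0ℤ < c → R i (u ⊕ c)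
      R-past-cycle {i} {u} i→u (y , w , u→y , y→w , u≋w) {c} 0<c with i ≋? y | u≋w
      ... | yes i≋y | _ = R-wrap i→u (≋-sym (≋-⊕ c)) (<-⊕ u 0<c) (≋-sym (≋-⊕ c)) i≋y u→y
      ... | no i≉y | ≋-⊕ m with m + 1ℤ <? c
      ...   | yes m+1<c = R-far-past-cycle i→u u→y y→w i≉y m+1<c
      ...   | no m+1≮c =
        R-fan i→u (R-far-past-cycle i→u u→y y→w i≉y (i<i+1 (m + 1ℤ)))
          (≋-sym (≋-⊕ c)) (≋-trans (≋-sym (≋-⊕ c)) (≋-⊕ _)) (<-⊕ u 0<c)
          (⊕-monoʳ-< u (≤-<-trans (≮⇒≥ m+1≮c) (i<i+1 (m + 1ℤ))))

      R-before-cycle : ∀ {u k} → Cycle u → ∀ {c} → 0ℤ < c → R (u ⊕ c) k → R u k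
      R-before-cycle {u} {k} (y , _ , u→y , y→w , ≋-⊕ m) {c} 0<c u⊕c→k = by-cases (k ≋? y)
        where
        k⁻ : ℤ
        k⁻ = k ⊕ (- c)
        u→k⁻ : R u k⁻
        u→k⁻ = subst (λ v → R v k⁻) (⊕-inverseʳ u c) (R-shift (- c) u⊕c→k)
        k⁻<k : k⁻ < k
        k⁻<k = ⊕-< k (neg-mono-< 0<c)
        by-cases : Dec (k ≋ y) → R u k
        by-cases (yes k≋y) = R-wrap u→k⁻ (≋-⊕ (- c)) k⁻<k k≋y (≋-⊕ m) y→w
        by-cases (no k≉y) = R-fan u→k⁻ u→k⁺ (≋-⊕ (- c)) (≋-⊕ (m + 1ℤ)) k⁻<k (<-⊕ k 0<m+1)
          where
          0<m+1 : 0ℤ < m + 1ℤ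
          0<m+1 = <-trans (<-⊕⁻¹ u (<-trans (R-< u→y) (R-< y→w))) (i<i+1 m)
          k⁺ : ℤ
          k⁺ = k ⊕ (m + 1ℤ)
          eq : u ⊕ c ⊕ (m + 1ℤ) ≡ u ⊕ m ⊕ (c + 1ℤ)
          eq = trans (⊕-assoc u c (m + 1ℤ)) (trans (cong (u ⊕_) (lemma c m)) (sym (⊕-assoc u m (c + 1ℤ))))
            where
            lemma : ∀ c m → c + (m + 1ℤ) ≡ m + (c + 1ℤ)
            lemma = solve-∀
          y→k⁺ : R y k⁺
          y→k⁺ = R-split (R-cycle-beyond u→y y→w (≋-⊕ m) (+-mono-< 0<c (+<+ ℕ.z<s)))
                   (subst (λ v → R v k⁺) eq (R-shift (m + 1ℤ) u⊕c→k))
                   (λ y≋k⁺ → k≉y (≋-sym (≋-trans y≋k⁺ (≋-sym (≋-⊕ (m + 1ℤ))))))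
          u→k⁺ : R u k⁺
          u→k⁺ = R-split u→y y→k⁺ λ u≋k⁺ →
            R-≉ u⊕c→k (≋-trans (≋-sym (≋-⊕ c)) (≋-trans u≋k⁺ (≋-sym (≋-⊕ (m + 1ℤ)))))

      Inv : ℤ → ℤ → Set
      Inv a b = (¬ a ≋ b → R a b) × (a ≋ b → Cycle a)

      Inv-trans : ∀ {a b c} → a < b → b < c → Inv a b → Inv b c → Inv a c
      Inv-trans {a} {b} {c} a<b b<c (R₁ , C₁) (R₂ , C₂) with a ≋? b | b ≋? c
      ... | no a≉b | no b≉c = (R-split (R₁ a≉b) (R₂ b≉c)) , (λ a≋c → _ , _ , R₁ a≉b , R₂ b≉c , a≋c)
      ... | no a≉b | yes (≋-⊕ s) =
        (λ _ → R-past-cycle (R₁ a≉b) (C₂ (≋-⊕ s)) (<-⊕⁻¹ b b<c)) ,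
        (λ a≋c → contradiction (≋-trans a≋c (≋-sym (≋-⊕ s))) a≉b)
      ... | yes (≋-⊕ s) | no b≉c =
        (λ _ → R-before-cycle (C₁ (≋-⊕ s)) (<-⊕⁻¹ a a<b) (R₂ b≉c)) ,
        (λ a≋c → contradiction (≋-trans (≋-sym (≋-⊕ s)) a≋c) b≉c)
      ... | yes a≋b | yes b≋c = (λ a≉c → contradiction (≋-trans a≋b b≋c) a≉c) , (λ _ → C₁ a≋b)

      Inv-closure : ∀ {Q : ℤ → ℤ → Set} → (∀ {a b} → Q a b → a < b × Inv a b) →
                    ∀ {a b} → TransClosure Q a b → a < b × Inv a b
      Inv-closure Q-Inv [ q ] = Q-Inv q
      Inv-closure Q-Inv (q ∷ p) with Q-Inv q | Inv-closure Q-Inv p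
      ... | a<m , I₁ | m<b , I₂ = <-trans a<m m<b , Inv-trans a<m m<b I₁ I₂

      S-Inv : ∀ {a b} → S a b → a < b × Inv a b
      S-Inv s = S-< s , (λ _ → S⇒R s) , (λ a≋b → contradiction a≋b (proj₂ (S⇒IsRoot s)))

      Step-Inv : ∀ {a b} → Step a b → a < b × Inv a b
      Step-Inv (edge s) = S-Inv s
      Step-Inv (wind {a} (d , _ , p) {c} 0<c) =
        <-⊕ a 0<c , (λ a≉ → contradiction (≋-⊕ c) a≉) , (λ _ → proj₂ (proj₂ (Inv-closure S-Inv p)) (≋-⊕ d))

      Reach⇒R : ∀ {a b} → Reach a b → ¬ a ≋ b → R a b
      Reach⇒R p = proj₁ (proj₂ (Inv-closure Step-Inv p))

module Roots (n : ℕ) .{{_ : NonZero n}} where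

  open Congruence n

  coord : V n → Fin n → ℤ
  coord v = lookup (proj₁ v)

  height : V n → ℤ
  height = proj₂

  V-ext : ∀ {u v : V n} → (∀ r → coord u r ≡ coord v r) → height u ≡ height v → u ≡ v
  V-ext {u , _} {v , _} eq = cong₂ _,_ (begin
    u                   ≡⟨ Vec.tabulate∘lookup u ⟨
    tabulate (lookup u) ≡⟨ Vec.tabulate-cong eq ⟩
    tabulate (lookup v) ≡⟨ Vec.tabulate∘lookup v ⟩
    v                   ∎)
    where open ≡-Reasoning

  coord-+ᵥ : ∀ (u v : V n) r → coord (u +ᵥ v) r ≡ coord u r + coord v r
  coord-+ᵥ (u , _) (v , _) r = Vec.lookup-zipWith _+_ r u v

  coord-·ᵥ : ∀ k (v : V n) r → coord (k ·ᵥ v) r ≡ + k * coord v r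
  coord-·ᵥ k (v , _) r = Vec.lookup-map r (+ k *_) v

  coord-combination : ∀ a b (α β : V n) r → coord ((a ·ᵥ α) +ᵥ (b ·ᵥ β)) r ≡ + a * coord α r + + b * coord β r
  coord-combination a b α β r = trans (coord-+ᵥ (a ·ᵥ α) (b ·ᵥ β) r) (cong₂ _+_ (coord-·ᵥ a α r) (coord-·ᵥ b β r))

  InCone-intro : ∀ {γ α β} A B C → 0ℤ < A → 0ℤ < B → 0ℤ < C →
                 (∀ r → C * coord γ r ≡ A * coord α r + B * coord β r) →
                 C * height γ ≡ A * height α + B * height β → InCone n γ α β
  InCone-intro +0 _ _ (+<+ ())
  InCone-intro _ +0 _ _ (+<+ ())
  InCone-intro _ _ +0 _ _ (+<+ ())
  InCone-intro {γ} {α} {β} +[1+ a ] +[1+ b ] +[1+ c ] _ _ _ coords heights =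
    ℕ.suc a , ℕ.suc b , ℕ.suc c , _ , _ , _ , V-ext coords′ heights
    where
    coords′ : ∀ r → coord (ℕ.suc c ·ᵥ γ) r ≡ coord ((ℕ.suc a ·ᵥ α) +ᵥ (ℕ.suc b ·ᵥ β)) r
    coords′ r = trans (coord-·ᵥ (ℕ.suc c) γ r) (trans (coords r) (sym (coord-combination (ℕ.suc a) (ℕ.suc b) α β r)))

  δ : ℕ → ℕ → ℤ
  δ p q = if p ≡ᵇ q then 1ℤ else 0ℤ

  δ-cases : ∀ p q → (p ≡ q × δ p q ≡ 1ℤ) ⊎ (p ≢ q × δ p q ≡ 0ℤ)
  δ-cases p q with p ≡ᵇ q in eq
  ... | true = inj₁ (ℕ.≡ᵇ⇒≡ p q (subst T (sym eq) _) , refl)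
  ... | false = inj₂ ((λ p≡q → subst T eq (ℕ.≡⇒≡ᵇ p q p≡q)) , refl)

  δ-diagonal : ∀ p → δ p p ≡ 1ℤ
  δ-diagonal p with δ-cases p p
  ... | inj₁ (_ , eq) = eq
  ... | inj₂ (p≢p , _) = contradiction refl p≢p

  δ-off-diagonal : ∀ {p q} → p ≢ q → δ p q ≡ 0ℤ
  δ-off-diagonal {p} {q} p≢q with δ-cases p q
  ... | inj₁ (p≡q , _) = contradiction p≡q p≢q
  ... | inj₂ (_ , eq) = eq

  δ-nonNeg : ∀ p q → 0ℤ ≤ δ p q
  δ-nonNeg p q with δ-cases p q
  ... | inj₁ (_ , eq) = subst (0ℤ ≤_) (sym eq) (+≤+ ℕ.z≤n)
  ... | inj₂ (_ , eq) = subst (0ℤ ≤_) (sym eq) ≤-refl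

  δ-difference-1 : ∀ p q r → δ p q - δ p r ≡ 1ℤ → p ≡ q
  δ-difference-1 p q r eq with δ-cases p q | δ-cases p r
  ... | inj₁ (p≡q , _) | _ = p≡q
  ... | inj₂ (_ , e₁) | inj₁ (_ , e₂) with trans (sym eq) (cong₂ _-_ e₁ e₂)
  ...   | ()
  δ-difference-1 p q r eq | inj₂ (_ , e₁) | inj₂ (_ , e₂) with trans (sym eq) (cong₂ _-_ e₁ e₂)
  ...   | ()

  δ-difference-−1 : ∀ p q r → δ p q - δ p r ≡ - 1ℤ → p ≡ r
  δ-difference-−1 p q r eq with δ-cases p q | δ-cases p r
  ... | _ | inj₁ (p≡r , _) = p≡r
  ... | inj₁ (_ , e₁) | inj₂ (_ , e₂) with trans (sym eq) (cong₂ _-_ e₁ e₂)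
  ...   | ()
  δ-difference-−1 p q r eq | inj₂ (_ , e₁) | inj₂ (_ , e₂) with trans (sym eq) (cong₂ _-_ e₁ e₂)
  ...   | ()

  root : ℤ → ℤ → V n
  root i j = ẽ n j -ᵥ ẽ n i

  coord-root : ∀ i j r → coord (root i j) r ≡ δ (toℕ r) (residue j) - δ (toℕ r) (residue i)
  coord-root i j r = trans (Vec.lookup-zipWith _-_ r (proj₁ (ẽ n j)) (proj₁ (ẽ n i)))
    (cong₂ _-_ (Vec.lookup∘tabulate (λ k → δ (toℕ k) (residue j)) r) (Vec.lookup∘tabulate (λ k → δ (toℕ k) (residue i)) r))

  ⟦_⟧ : ℤ → Fin n
  ⟦ x ⟧ = fromℕ< (residue<n x)

  coord-root-⟦⟧ : ∀ x i j → coord (root i j) ⟦ x ⟧ ≡ δ (residue x) (residue j) - δ (residue x) (residue i)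
  coord-root-⟦⟧ x i j = trans (coord-root i j ⟦ x ⟧) (cong (λ p → δ p (residue j) - δ p (residue i)) (Fin.toℕ-fromℕ< (residue<n x)))

  coord-root-≋ : ∀ {i j i' j'} → i ≋ i' → j ≋ j' → ∀ r → coord (root i j) r ≡ coord (root i' j') r
  coord-root-≋ {i} {j} {i'} {j'} i≋i' j≋j' r = begin
    coord (root i j) r                                   ≡⟨ coord-root i j r ⟩
    δ (toℕ r) (residue j) - δ (toℕ r) (residue i)        ≡⟨ cong₂ (λ p q → δ (toℕ r) p - δ (toℕ r) q)
                                                               (≋⇒residue≡ j≋j') (≋⇒residue≡ i≋i') ⟩
    δ (toℕ r) (residue j') - δ (toℕ r) (residue i')      ≡⟨ coord-root i' j' r ⟨
    coord (root i' j') r                                 ∎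
    where open ≡-Reasoning

  coord-root-swap : ∀ i j r → coord (root j i) r ≡ - coord (root i j) r
  coord-root-swap i j r =
    trans (coord-root j i r) (trans (lemma (δ (toℕ r) (residue i)) (δ (toℕ r) (residue j))) (cong -_ (sym (coord-root i j r))))
    where
    lemma : ∀ a b → a - b ≡ - (b - a)
    lemma = solve-∀

  height-root-⊕ʳ : ∀ i k t → height (root i (k ⊕ t)) ≡ height (root i k) + t
  height-root-⊕ʳ i k t = trans (cong (_- i /ℕ n) (proj₂ (divmod-⊕ k t))) (lemma (k /ℕ n) (i /ℕ n) t)
    where
    lemma : ∀ a b t → a + t - b ≡ a - b + t
    lemma = solve-∀

  root-shift : ∀ i j s → root (i ⊕ s) (j ⊕ s) ≡ root i j
  root-shift i j s = V-ext (λ r → sym (coord-root-≋ (≋-⊕ s) (≋-⊕ s) r))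
    (trans (cong₂ _-_ (proj₂ (divmod-⊕ j s)) (proj₂ (divmod-⊕ i s))) (lemma (j /ℕ n) (i /ℕ n) s))
    where
    lemma : ∀ a b s → a + s - (b + s) ≡ a - b
    lemma = solve-∀

  length-root : ∀ i j → j - i ≡ (+ residue j - + residue i) ⊕ height (root i j)
  length-root i j = trans (cong₂ _-_ (residue+quotient j) (residue+quotient i)) (⊕-minus-⊕ _ _ _ _)

  length-≡ : ∀ {i j i' j'} → i ≋ i' → j ≋ j' → height (root i j) ≡ height (root i' j') → j - i ≡ j' - i'
  length-≡ {i} {j} {i'} {j'} i≋i' j≋j' h≡h' = begin
    j - i                                                   ≡⟨ length-root i j ⟩
    (+ residue j - + residue i) ⊕ height (root i j)         ≡⟨ cong₂ (λ p q → (+ p - + q) ⊕ height (root i j))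
                                                                 (≋⇒residue≡ j≋j') (≋⇒residue≡ i≋i') ⟩
    (+ residue j' - + residue i') ⊕ height (root i j)       ≡⟨ cong ((+ residue j' - + residue i') ⊕_) h≡h' ⟩
    (+ residue j' - + residue i') ⊕ height (root i' j')     ≡⟨ length-root i' j' ⟨
    j' - i'                                                 ∎
    where open ≡-Reasoning

  root-injective : ∀ {i j i' j'} → IsRoot i j → root i j ≡ root i' j' → i ≋ i' × j' - i' ≡ j - i
  root-injective {i} {j} {i'} {j'} (_ , i≉j) eq = i≋i' , sym (length-≡ i≋i' j≋j' (cong height eq))
    where
    at : ∀ x → δ (residue x) (residue j') - δ (residue x) (residue i') ≡ δ (residue x) (residue j) - δ (residue x) (residue i)
    at x = trans (sym (coord-root-⟦⟧ x i' j')) (trans (cong (λ v → coord v ⟦ x ⟧) (sym eq)) (coord-root-⟦⟧ x i j))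
    j≋j' : j ≋ j'
    j≋j' = residue≡⇒≋ (δ-difference-1 _ _ _
             (trans (at j) (cong₂ _-_ (δ-diagonal (residue j)) (δ-off-diagonal (i≉j ∘ ≋-sym ∘ residue≡⇒≋)))))
    i≋i' : i ≋ i'
    i≋i' = residue≡⇒≋ (δ-difference-−1 _ _ _
             (trans (at i) (cong₂ _-_ (δ-off-diagonal (i≉j ∘ residue≡⇒≋)) (δ-diagonal (residue i)))))

  IsRoot-shift : ∀ {i j} s → IsRoot i j → IsRoot (i ⊕ s) (j ⊕ s)
  IsRoot-shift s (i<j , i≉j) =
    ⊕-monoˡ-< s i<j , λ i⊕s≋j⊕s → i≉j (≋-trans (≋-⊕ s) (≋-trans i⊕s≋j⊕s (≋-sym (≋-⊕ s))))

  IsRoot⇒Φ⁺ : ∀ {i j} → IsRoot i j → Φ⁺ n (root i j)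
  IsRoot⇒Φ⁺ {i} {j} (i<j , i≉j) = i , j , i<j , i≉j ∘ ∣⇒≋ , refl

  Φ⁺⇒IsRoot : ∀ {v} → Φ⁺ n v → Σ ℤ λ i → Σ ℤ λ j → IsRoot i j × v ≡ root i j
  Φ⁺⇒IsRoot (i , j , i<j , n∤j-i , eq) = i , j , (i<j , n∤j-i ∘ ≋⇒∣) , eq

  height-opposite-pos : ∀ {x y x' y'} → IsRoot x y → IsRoot y' x' → x ≋ x' → y ≋ y' →
                        0ℤ < height (root x y) + height (root y' x')
  height-opposite-pos {x} {y} (x<y , _) (y'<x' , _) (≋-⊕ p) (≋-⊕ q) = subst (0ℤ <_) (sym sum) 0<p-q
    where
    0<p-q : 0ℤ < p - q
    0<p-q = subst (_< p - q) (+-inverseʳ q) (+-monoˡ-< (- q) (⊕-cancelʳ-< x (<-trans (⊕-monoˡ-< q x<y) y'<x')))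
    sum : height (root x y) + height (root (y ⊕ q) (x ⊕ p)) ≡ p - q
    sum = trans (cong₂ (λ a b → y /ℕ n - x /ℕ n + (a - b)) (proj₂ (divmod-⊕ x p)) (proj₂ (divmod-⊕ y q)))
                (lemma (y /ℕ n) (x /ℕ n) p q)
      where
      lemma : ∀ a b p q → a - b + (b + p - (a + q)) ≡ p - q
      lemma = solve-∀

  root-difference : ∀ i j k → (∀ r → coord (root j k) r ≡ coord (root i k) r - coord (root i j) r) ×
                              height (root j k) ≡ height (root i k) - height (root i j)
  root-difference i j k = coords , lemma (i /ℕ n) (j /ℕ n) (k /ℕ n)
    where
    lemma : ∀ a b c → c - b ≡ c - a - (b - a)
    lemma = solve-∀
    coords : ∀ r → coord (root j k) r ≡ coord (root i k) r - coord (root i j) r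
    coords r = trans (coord-root j k r) (trans (lemma (δ (toℕ r) (residue i)) (δ (toℕ r) (residue j)) (δ (toℕ r) (residue k)))
                 (sym (cong₂ _-_ (coord-root i k r) (coord-root i j r))))

  cone-split : ∀ {i j k} → InCone n (root i k) (root i j) (root j k)
  cone-split {i} {j} {k} = InCone-intro 1ℤ 1ℤ 1ℤ (+<+ ℕ.z<s) (+<+ ℕ.z<s) (+<+ ℕ.z<s)
    (λ r → unit-sum (proj₁ (root-difference i j k) r)) (unit-sum (proj₂ (root-difference i j k)))
    where
    unit-sum : ∀ {g a b} → b ≡ g - a → 1ℤ * g ≡ 1ℤ * a + 1ℤ * b
    unit-sum {g} {a} refl = lemma g a
      where
      lemma : ∀ g a → 1ℤ * g ≡ 1ℤ * a + 1ℤ * (g - a)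
      lemma = solve-∀

  cone-fan : ∀ {i k k₁ k₂} → k ≋ k₁ → k ≋ k₂ → k₁ < k → k < k₂ → InCone n (root i k) (root i k₁) (root i k₂)
  cone-fan {i} {k} (≋-⊕ t₁) (≋-⊕ t₂) k₁<k k<k₂ =
    InCone-intro t₂ (- t₁) (t₂ - t₁) 0<t₂ 0<-t₁ (+-mono-< 0<t₂ 0<-t₁) coords heights
    where
    0<t₂ : 0ℤ < t₂
    0<t₂ = <-⊕⁻¹ k k<k₂
    0<-t₁ : 0ℤ < - t₁
    0<-t₁ = neg-mono-< (⊕-<⁻¹ k k₁<k)
    coords : ∀ r → (t₂ - t₁) * coord (root i k) r ≡ t₂ * coord (root i (k ⊕ t₁)) r + - t₁ * coord (root i (k ⊕ t₂)) r
    coords r = trans (lemma t₁ t₂ (coord (root i k) r))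
      (cong₂ (λ a b → t₂ * a + - t₁ * b) (coord-root-≋ (≋-refl {i}) (≋-⊕ t₁) r) (coord-root-≋ (≋-refl {i}) (≋-⊕ t₂) r))
      where
      lemma : ∀ t₁ t₂ x → (t₂ - t₁) * x ≡ t₂ * x + - t₁ * x
      lemma = solve-∀
    heights : (t₂ - t₁) * height (root i k) ≡ t₂ * height (root i (k ⊕ t₁)) + - t₁ * height (root i (k ⊕ t₂))
    heights = trans (lemma t₁ t₂ (height (root i k)))
      (cong₂ (λ a b → t₂ * a + - t₁ * b) (sym (height-root-⊕ʳ i k t₁)) (sym (height-root-⊕ʳ i k t₂)))
      where
      lemma : ∀ t₁ t₂ h → (t₂ - t₁) * h ≡ t₂ * (h + t₁) + - t₁ * (h + t₂)
      lemma = solve-∀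

  cone-wrap : ∀ {i k k₁ k' i'} → IsRoot i k₁ → k ≋ k₁ → k₁ < k → IsRoot k' i' → k ≋ k' → i ≋ i' →
              InCone n (root i k) (root i k₁) (root k' i')
  cone-wrap {i} {k} {_} {k'} {i'} i↝k₁ (≋-⊕ t) k₁<k k'↝i' k≋k' i≋i' = InCone-intro A s C 0<A 0<s 0<C coords heights
    where
    h hβ s A C : ℤ
    h = height (root i k)
    hβ = height (root k' i')
    s = - t
    0<s : 0ℤ < s
    0<s = neg-mono-< (⊕-<⁻¹ k k₁<k)
    h₁≡ : height (root i (k ⊕ t)) ≡ h - s
    h₁≡ = trans (height-root-⊕ʳ i k t) (cong (λ x → h + x) (sym (neg-involutive t)))
    A = h + hβ
    C = h - s + hβ
    i↝k : IsRoot i k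
    i↝k = <-trans (proj₁ i↝k₁) k₁<k , λ i≋k → proj₂ i↝k₁ (≋-⊕ʳ t i≋k)
    0<A : 0ℤ < A
    0<A = height-opposite-pos i↝k k'↝i' i≋i' k≋k'
    0<C : 0ℤ < C
    0<C = subst (λ h₁ → 0ℤ < h₁ + hβ) h₁≡ (height-opposite-pos i↝k₁ k'↝i' i≋i' (≋-trans (≋-sym (≋-⊕ t)) k≋k'))
    coords : ∀ r → C * coord (root i k) r ≡ A * coord (root i (k ⊕ t)) r + s * coord (root k' i') r
    coords r = trans (lemma h hβ s (coord (root i k) r))
      (cong₂ (λ a b → A * a + s * b) (coord-root-≋ (≋-refl {i}) (≋-⊕ t) r)
        (sym (trans (sym (coord-root-≋ k≋k' i≋i' r)) (coord-root-swap i k r))))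
      where
      lemma : ∀ h hβ s x → (h - s + hβ) * x ≡ (h + hβ) * x + s * (- x)
      lemma = solve-∀
    heights : C * h ≡ A * height (root i (k ⊕ t)) + s * hβ
    heights = trans (lemma h hβ s) (cong (λ h₁ → A * h₁ + s * hβ) (sym h₁≡))
      where
      lemma : ∀ h hβ s → (h - s + hβ) * h ≡ (h + hβ) * (h - s) + s * hβ
      lemma = solve-∀

  realign : ∀ {i₁ j₁ i} → IsRoot i₁ j₁ → i₁ ≋ i →
            Σ ℤ λ k₁ → root i₁ j₁ ≡ root i k₁ × IsRoot i k₁ × j₁ ≋ k₁
  realign {i₁} {j₁} i₁↝j₁ (≋-⊕ s) = j₁ ⊕ s , sym (root-shift i₁ j₁ s) , IsRoot-shift s i₁↝j₁ , ≋-⊕ s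

  data Shape (i k : ℤ) (α β : V n) : Set where
    split : ∀ {j} → IsRoot i j → IsRoot j k → α ≡ root i j → β ≡ root j k → Shape i k α β
    fan   : ∀ {k₁ k₂} → k ≋ k₁ → k ≋ k₂ → i < k₁ → k₁ < k → k < k₂ →
            α ≡ root i k₁ → β ≡ root i k₂ → Shape i k α β
    wrap  : ∀ {k₁ k' i'} → k ≋ k₁ → i < k₁ → k₁ < k → α ≡ root i k₁ →
            IsRoot k' i' → k ≋ k' → i ≋ i' → β ≡ root k' i' → Shape i k α β
    same  : α ≡ root i k → Shape i k α β

  Shape± : ℤ → ℤ → V n → V n → Set
  Shape± i k α β = Shape i k α β ⊎ Shape i k β α

  -- Comparing the coordinates of C γ = A α + B β at the residues of the endpoints determines the residues
  -- of the endpoints of α and β; comparing heights then locates the endpoints.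
  private
    module Classify {i k i₁ j₁ i₂ j₂ : ℤ} (i↝k : IsRoot i k) (i₁↝j₁ : IsRoot i₁ j₁) (i₂↝j₂ : IsRoot i₂ j₂)
                    (a b c : ℕ) (eq : ℕ.suc c ·ᵥ root i k ≡ (ℕ.suc a ·ᵥ root i₁ j₁) +ᵥ (ℕ.suc b ·ᵥ root i₂ j₂)) where

      A B C : ℤ
      A = +[1+ a ]
      B = +[1+ b ]
      C = +[1+ c ]

      I K I₁ J₁ I₂ J₂ : ℕ
      I = residue i
      K = residue k
      I₁ = residue i₁
      J₁ = residue j₁
      I₂ = residue i₂
      J₂ = residue j₂

      α β : V n
      α = root i₁ j₁
      β = root i₂ j₂

      coords : ∀ r → C * coord (root i k) r ≡ A * coord α r + B * coord β r
      coords r = trans (sym (coord-·ᵥ (ℕ.suc c) (root i k) r))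
                   (trans (cong (λ v → coord v r) eq) (coord-combination (ℕ.suc a) (ℕ.suc b) α β r))

      heights : C * height (root i k) ≡ A * height α + B * height β
      heights = cong proj₂ eq

      -- A record, so that evaluate recovers the six entries by unification.
      record Balanced (d₁ d₂ d₃ d₄ d₅ d₆ : ℤ) : Set where
        constructor balanced
        field equation : C * (d₁ - d₂) ≡ A * (d₃ - d₄) + B * (d₅ - d₆)

      balanced-at : ∀ x → let X = residue x in Balanced (δ X K) (δ X I) (δ X J₁) (δ X I₁) (δ X J₂) (δ X I₂)
      balanced-at x = balanced (begin
        C * (δ X K - δ X I)                               ≡⟨ cong (C *_) (coord-root-⟦⟧ x i k) ⟨
        C * coord (root i k) ⟦ x ⟧                        ≡⟨ coords ⟦ x ⟧ ⟩
        A * coord α ⟦ x ⟧ + B * coord β ⟦ x ⟧             ≡⟨ cong₂ (λ p q → A * p + B * q)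
                                                                 (coord-root-⟦⟧ x i₁ j₁) (coord-root-⟦⟧ x i₂ j₂) ⟩
        A * (δ X J₁ - δ X I₁) + B * (δ X J₂ - δ X I₂)     ∎)
        where
        open ≡-Reasoning
        X : ℕ
        X = residue x

      evaluate : ∀ {d₁ d₂ d₃ d₄ d₅ d₆ v₁ v₂ v₃ v₄ v₅ v₆} → Balanced d₁ d₂ d₃ d₄ d₅ d₆ →
                 d₁ ≡ v₁ → d₂ ≡ v₂ → d₃ ≡ v₃ → d₄ ≡ v₄ → d₅ ≡ v₅ → d₆ ≡ v₆ →
                 Balanced v₁ v₂ v₃ v₄ v₅ v₆
      evaluate e refl refl refl refl refl refl = e

      private
        factor-zero : ∀ m {x} → +[1+ m ] * x ≡ 0ℤ → x ≡ 0ℤ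
        factor-zero m p with i*j≡0⇒i≡0∨j≡0 +[1+ m ] p
        ... | inj₁ ()
        ... | inj₂ x≡0 = x≡0

        0≤* : ∀ m {x} → 0ℤ ≤ x → 0ℤ ≤ +[1+ m ] * x
        0≤* m {x} 0≤x = subst (_≤ +[1+ m ] * x) (*-zeroʳ +[1+ m ]) (*-monoˡ-≤-nonNeg +[1+ m ] 0≤x)

      balanced-A : ∀ {d₃ d₄} → Balanced 0ℤ 0ℤ d₃ d₄ 0ℤ 0ℤ → d₃ ≡ d₄
      balanced-A {d₃} {d₄} (balanced e) =
        i-j≡0⇒i≡j d₃ d₄ (factor-zero a (trans (sym (lemma A B (d₃ - d₄))) (trans (sym e) (*-zeroʳ C))))
        where
        lemma : ∀ A B x → A * x + B * (0ℤ - 0ℤ) ≡ A * x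
        lemma = solve-∀

      balanced-B : ∀ {d₅ d₆} → Balanced 0ℤ 0ℤ 0ℤ 0ℤ d₅ d₆ → d₅ ≡ d₆
      balanced-B {d₅} {d₆} (balanced e) =
        i-j≡0⇒i≡j d₅ d₆ (factor-zero b (trans (sym (lemma A B (d₅ - d₆))) (trans (sym e) (*-zeroʳ C))))
        where
        lemma : ∀ A B x → A * (0ℤ - 0ℤ) + B * x ≡ B * x
        lemma = solve-∀

      unbalanced-top : ∀ {d₄ d₆} → 0ℤ ≤ d₄ → 0ℤ ≤ d₆ → ¬ Balanced 1ℤ 0ℤ 0ℤ d₄ 0ℤ d₆
      unbalanced-top {d₄} {d₆} 0≤d₄ 0≤d₆ (balanced e) =
        <⇒≱ (+<+ ℕ.z<s) (subst (_≤ 0ℤ) (trans (sym (lemma A B d₄ d₆)) (trans (sym e) (*-identityʳ C)))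
                           (neg-mono-≤ (+-mono-≤ (0≤* a 0≤d₄) (0≤* b 0≤d₆))))
        where
        lemma : ∀ A B x y → A * (0ℤ - x) + B * (0ℤ - y) ≡ - (A * x + B * y)
        lemma = solve-∀

      unbalanced-bottom : ∀ {d₃ d₅} → 0ℤ ≤ d₃ → 0ℤ ≤ d₅ → ¬ Balanced 0ℤ 1ℤ d₃ 0ℤ d₅ 0ℤ
      unbalanced-bottom {d₃} {d₅} 0≤d₃ 0≤d₅ (balanced e) =
        <⇒≱ (+<+ ℕ.z<s) (subst (_≤ 0ℤ) (neg-involutive C)
          (neg-mono-≤ (subst (0ℤ ≤_) (trans (sym (lemma₂ A B d₃ d₅)) (trans (sym e) (lemma₁ C)))
                                    (+-mono-≤ (0≤* a 0≤d₃) (0≤* b 0≤d₅)))))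
        where
        lemma₁ : ∀ C → C * (0ℤ - 1ℤ) ≡ - C
        lemma₁ = solve-∀
        lemma₂ : ∀ A B x y → A * (x - 0ℤ) + B * (y - 0ℤ) ≡ A * x + B * y
        lemma₂ = solve-∀

      fan-coefficients : Balanced 1ℤ 0ℤ 1ℤ 0ℤ 1ℤ 0ℤ → C ≡ A + B
      fan-coefficients (balanced e) = trans (sym (*-identityʳ C)) (trans e (cong₂ _+_ (*-identityʳ A) (*-identityʳ B)))

      wrap-coefficients : Balanced 1ℤ 0ℤ 1ℤ 0ℤ 0ℤ 1ℤ → A ≡ C + B
      wrap-coefficients (balanced e) = trans (sym (lemma A B)) (cong (_+ B) (trans (sym e) (*-identityʳ C)))
        where
        lemma : ∀ A B → A * (1ℤ - 0ℤ) + B * (0ℤ - 1ℤ) + B ≡ A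
        lemma = solve-∀

      split-coefficientsᵃ : Balanced 1ℤ 0ℤ 1ℤ 0ℤ 0ℤ 0ℤ → C ≡ A
      split-coefficientsᵃ (balanced e) = trans (sym (*-identityʳ C)) (trans e (lemma A B))
        where
        lemma : ∀ A B → A * (1ℤ - 0ℤ) + B * (0ℤ - 0ℤ) ≡ A
        lemma = solve-∀

      split-coefficientsᵇ : Balanced 0ℤ 1ℤ 0ℤ 0ℤ 0ℤ 1ℤ → C ≡ B
      split-coefficientsᵇ (balanced e) = neg-injective (trans (sym (lemma₁ C)) (trans e (lemma₂ A B)))
        where
        lemma₁ : ∀ C → C * (0ℤ - 1ℤ) ≡ - C
        lemma₁ = solve-∀
        lemma₂ : ∀ A B → A * (0ℤ - 0ℤ) + B * (0ℤ - 1ℤ) ≡ - B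
        lemma₂ = solve-∀

      I≢K : I ≢ K
      I≢K = proj₂ i↝k ∘ residue≡⇒≋
      I₁≢J₁ : I₁ ≢ J₁
      I₁≢J₁ = proj₂ i₁↝j₁ ∘ residue≡⇒≋
      I₂≢J₂ : I₂ ≢ J₂
      I₂≢J₂ = proj₂ i₂↝j₂ ∘ residue≡⇒≋

      K-end : K ≡ J₁ ⊎ K ≡ J₂
      K-end with K ℕ.≟ J₁ | K ℕ.≟ J₂
      ... | yes K≡J₁ | _ = inj₁ K≡J₁
      ... | no _ | yes K≡J₂ = inj₂ K≡J₂
      ... | no K≢J₁ | no K≢J₂ = ⊥-elim (unbalanced-top (δ-nonNeg K I₁) (δ-nonNeg K I₂)
              (evaluate (balanced-at k) (δ-diagonal K) (δ-off-diagonal (I≢K ∘ sym))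
                 (δ-off-diagonal K≢J₁) refl (δ-off-diagonal K≢J₂) refl))

      I-start : I ≡ I₁ ⊎ I ≡ I₂
      I-start with I ℕ.≟ I₁ | I ℕ.≟ I₂
      ... | yes I≡I₁ | _ = inj₁ I≡I₁
      ... | no _ | yes I≡I₂ = inj₂ I≡I₂
      ... | no I≢I₁ | no I≢I₂ = ⊥-elim (unbalanced-bottom (δ-nonNeg I J₁) (δ-nonNeg I J₂)
              (evaluate (balanced-at i) (δ-off-diagonal I≢K) (δ-diagonal I) refl (δ-off-diagonal I≢I₁) refl (δ-off-diagonal I≢I₂)))

      private
        δ-≡ : ∀ {p q} → p ≡ q → δ p q ≡ 1ℤ
        δ-≡ {p} refl = δ-diagonal p

        opposite-sign : ∀ {x y} → A * x + B * y ≡ 0ℤ → x < 0ℤ → 0ℤ < y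
        opposite-sign {x} {y} balance x<0 = *-cancelˡ-<-nonNeg B (subst₂ _<_ (sym (*-zeroʳ B)) (sym By≡) (neg-mono-< Ax<0))
          where
          Ax<0 : A * x < 0ℤ
          Ax<0 = subst (A * x <_) (*-zeroʳ A) (*-monoˡ-<-pos A x<0)
          By≡ : B * y ≡ - (A * x)
          By≡ = trans (sym (lemma (A * x) (B * y))) (trans (cong (_- A * x) balance) (+-identityˡ (- (A * x))))
            where
            lemma : ∀ p q → p + q - p ≡ q
            lemma = solve-∀

        opposite-sign′ : ∀ {x y} → A * x + B * y ≡ 0ℤ → 0ℤ < x → y < 0ℤ
        opposite-sign′ {x} {y} balance 0<x =
          neg-cancel-< (opposite-sign (trans (lemma A B x y) (cong -_ balance)) (neg-mono-< 0<x))
          where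
          lemma : ∀ A B x y → A * - x + B * - y ≡ - (A * x + B * y)
          lemma = solve-∀

      parallel-other : K ≡ J₁ → I ≡ I₁ → ∀ x → residue x ≢ K → residue x ≢ I → δ (residue x) J₂ ≡ δ (residue x) I₂
      parallel-other K≡J₁ I≡I₁ x X≢K X≢I = balanced-B (evaluate (balanced-at x)
        (δ-off-diagonal X≢K) (δ-off-diagonal X≢I)
        (δ-off-diagonal (λ X≡J₁ → X≢K (trans X≡J₁ (sym K≡J₁))))
        (δ-off-diagonal (λ X≡I₁ → X≢I (trans X≡I₁ (sym I≡I₁)))) refl refl)

      parallel-β-end : K ≡ J₁ → I ≡ I₁ → ∀ x → residue x ≡ J₂ ⊎ residue x ≡ I₂ → residue x ≡ K ⊎ residue x ≡ I
      parallel-β-end K≡J₁ I≡I₁ x X∈β with residue x ℕ.≟ K | residue x ℕ.≟ I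
      ... | yes X≡K | _ = inj₁ X≡K
      ... | no _ | yes X≡I = inj₂ X≡I
      ... | no X≢K | no X≢I = ⊥-elim (differs X∈β (parallel-other K≡J₁ I≡I₁ x X≢K X≢I))
        where
        differs : residue x ≡ J₂ ⊎ residue x ≡ I₂ → δ (residue x) J₂ ≢ δ (residue x) I₂
        differs (inj₁ X≡J₂) eq
          with trans (sym (δ-≡ X≡J₂)) (trans eq (δ-off-diagonal (λ X≡I₂ → I₂≢J₂ (trans (sym X≡I₂) X≡J₂))))
        ... | ()
        differs (inj₂ X≡I₂) eq
          with trans (sym (δ-off-diagonal (λ X≡J₂ → I₂≢J₂ (trans (sym X≡I₂) X≡J₂)))) (trans eq (δ-≡ X≡I₂))
        ... | ()

      parallel-β : K ≡ J₁ → I ≡ I₁ → (J₂ ≡ K × I₂ ≡ I) ⊎ (J₂ ≡ I × I₂ ≡ K)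
      parallel-β K≡J₁ I≡I₁ with parallel-β-end K≡J₁ I≡I₁ j₂ (inj₁ refl) | parallel-β-end K≡J₁ I≡I₁ i₂ (inj₂ refl)
      ... | inj₁ J₂≡K | inj₂ I₂≡I = inj₁ (J₂≡K , I₂≡I)
      ... | inj₂ J₂≡I | inj₁ I₂≡K = inj₂ (J₂≡I , I₂≡K)
      ... | inj₁ J₂≡K | inj₁ I₂≡K = ⊥-elim (I₂≢J₂ (trans I₂≡K (sym J₂≡K)))
      ... | inj₂ J₂≡I | inj₂ I₂≡I = ⊥-elim (I₂≢J₂ (trans I₂≡I (sym J₂≡I)))

      fan-balance : ∀ {t₁ t₂} → α ≡ root i (k ⊕ t₁) → β ≡ root i (k ⊕ t₂) → C ≡ A + B → A * t₁ + B * t₂ ≡ 0ℤ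
      fan-balance {t₁} {t₂} α≡ β≡ refl = begin
        A * t₁ + B * t₂                               ≡⟨ lemma A B h t₁ t₂ ⟨
        A * (h + t₁) + B * (h + t₂) - (A + B) * h     ≡⟨ cong₂ (λ p q → A * p + B * q - (A + B) * h) h₁≡ h₂≡ ⟨
        A * height α + B * height β - (A + B) * h     ≡⟨ cong (_- (A + B) * h) heights ⟨
        (A + B) * h - (A + B) * h                     ≡⟨ +-inverseʳ ((A + B) * h) ⟩
        0ℤ                                            ∎
        where
        open ≡-Reasoning
        h : ℤ
        h = height (root i k)
        h₁≡ : height α ≡ h + t₁
        h₁≡ = trans (cong height α≡) (height-root-⊕ʳ i k t₁)
        h₂≡ : height β ≡ h + t₂
        h₂≡ = trans (cong height β≡) (height-root-⊕ʳ i k t₂)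
        lemma : ∀ A B h t₁ t₂ → A * (h + t₁) + B * (h + t₂) - (A + B) * h ≡ A * t₁ + B * t₂
        lemma = solve-∀

      fan-or-same : ∀ {k₁ k₂} → k ≋ k₁ → k ≋ k₂ → α ≡ root i k₁ → β ≡ root i k₂ →
                    IsRoot i k₁ → IsRoot i k₂ → C ≡ A + B → Shape± i k α β
      fan-or-same (≋-⊕ t₁) (≋-⊕ t₂) α≡ β≡ i↝k₁ i↝k₂ C≡A+B with <-cmp t₁ 0ℤ
      ... | tri< t₁<0 _ _ =
        inj₁ (fan (≋-⊕ t₁) (≋-⊕ t₂) (proj₁ i↝k₁) (⊕-< k t₁<0)
                  (<-⊕ k (opposite-sign (fan-balance α≡ β≡ C≡A+B) t₁<0)) α≡ β≡)
      ... | tri≈ _ refl _ = inj₁ (same (trans α≡ (cong (root i) (⊕-identityʳ k))))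
      ... | tri> _ _ 0<t₁ =
        inj₂ (fan (≋-⊕ t₂) (≋-⊕ t₁) (proj₁ i↝k₂) (⊕-< k (opposite-sign′ (fan-balance α≡ β≡ C≡A+B) 0<t₁))
                  (<-⊕ k 0<t₁) β≡ α≡)

      wrap-shape : K ≡ J₁ → I ≡ I₁ → J₂ ≡ I → I₂ ≡ K →
                   ∀ {k₁} → k ≋ k₁ → α ≡ root i k₁ → IsRoot i k₁ → Shape i k α β
      wrap-shape K≡J₁ I≡I₁ J₂≡I I₂≡K (≋-⊕ t) α≡ i↝k₁ =
        wrap (≋-⊕ t) (proj₁ i↝k₁) (⊕-< k t<0) α≡ i₂↝j₂ k≋i₂ i≋j₂ refl
        where
        h h₁ h₂ : ℤ
        h = height (root i k)
        h₁ = height (root i (k ⊕ t))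
        h₂ = height β
        k≋i₂ : k ≋ i₂
        k≋i₂ = residue≡⇒≋ (sym I₂≡K)
        i≋j₂ : i ≋ j₂
        i≋j₂ = residue≡⇒≋ (sym J₂≡I)
        A≡C+B : A ≡ C + B
        A≡C+B = wrap-coefficients (evaluate (balanced-at k) (δ-diagonal K) (δ-off-diagonal (I≢K ∘ sym)) (δ-≡ K≡J₁)
          (δ-off-diagonal (λ K≡I₁ → I≢K (trans I≡I₁ (sym K≡I₁))))
          (δ-off-diagonal (λ K≡J₂ → I≢K (trans (sym J₂≡I) (sym K≡J₂))))
          (δ-≡ (sym I₂≡K)))
        E≡0 : (C + B) * (h + t) + B * h₂ - C * h ≡ 0ℤ
        E≡0 = begin
          (C + B) * (h + t) + B * h₂ - C * h    ≡⟨ cong₂ (λ p q → p * q + B * h₂ - C * h) A≡C+B (height-root-⊕ʳ i k t) ⟨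
          A * h₁ + B * h₂ - C * h               ≡⟨ cong (λ v → A * height v + B * h₂ - C * h) α≡ ⟨
          A * height α + B * h₂ - C * h         ≡⟨ cong (_- C * h) heights ⟨
          C * h - C * h                         ≡⟨ +-inverseʳ (C * h) ⟩
          0ℤ                                    ∎
          where open ≡-Reasoning
        balance : C * (- t) ≡ B * (h + t + h₂)
        balance = trans (lemma C B h t h₂) (trans (cong (λ e → B * (h + t + h₂) - e) E≡0) (+-identityʳ _))
          where
          lemma : ∀ C B h t h₂ → C * (- t) ≡ B * (h + t + h₂) - ((C + B) * (h + t) + B * h₂ - C * h)
          lemma = solve-∀
        0<h₁+h₂ : 0ℤ < h + t + h₂
        0<h₁+h₂ = subst (λ x → 0ℤ < x + h₂) (height-root-⊕ʳ i k t)
                    (height-opposite-pos i↝k₁ i₂↝j₂ i≋j₂ (≋-trans (≋-sym (≋-⊕ t)) k≋i₂))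
        t<0 : t < 0ℤ
        t<0 = neg-cancel-< (*-cancelˡ-<-nonNeg C (subst₂ _<_ (sym (*-zeroʳ C)) (sym balance)
                (subst (_< B * (h + t + h₂)) (*-zeroʳ B) (*-monoˡ-<-pos B 0<h₁+h₂))))

      parallel : K ≡ J₁ → I ≡ I₁ → Shape± i k α β
      parallel K≡J₁ I≡I₁ with realign i₁↝j₁ (residue≡⇒≋ (sym I≡I₁)) | parallel-β K≡J₁ I≡I₁
      ... | k₁ , α≡ , i↝k₁ , j₁≋k₁ | inj₂ (J₂≡I , I₂≡K) =
        inj₁ (wrap-shape K≡J₁ I≡I₁ J₂≡I I₂≡K (≋-trans (residue≡⇒≋ K≡J₁) j₁≋k₁) α≡ i↝k₁)
      ... | k₁ , α≡ , i↝k₁ , j₁≋k₁ | inj₁ (J₂≡K , I₂≡I) with realign i₂↝j₂ (residue≡⇒≋ I₂≡I)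
      ...   | k₂ , β≡ , i↝k₂ , j₂≋k₂ =
        fan-or-same (≋-trans (residue≡⇒≋ K≡J₁) j₁≋k₁) (≋-trans (residue≡⇒≋ (sym J₂≡K)) j₂≋k₂)
          α≡ β≡ i↝k₁ i↝k₂
          (fan-coefficients (evaluate (balanced-at k) (δ-diagonal K) (δ-off-diagonal (I≢K ∘ sym)) (δ-≡ K≡J₁)
            (δ-off-diagonal (λ K≡I₁ → I≢K (trans I≡I₁ (sym K≡I₁)))) (δ-≡ (sym J₂≡K))
            (δ-off-diagonal (λ K≡I₂ → I≢K (sym (trans K≡I₂ I₂≡I))))))

      split-shape : K ≡ J₁ → I ≡ I₂ → I ≢ I₁ → K ≢ J₂ → Shape i k β α
      split-shape K≡J₁ I≡I₂ I≢I₁ K≢J₂ with I₁ ℕ.≟ J₂ | realign i₂↝j₂ (residue≡⇒≋ (sym I≡I₂))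
      ... | no I₁≢J₂ | _ = contradiction (balanced-A (evaluate (balanced-at i₁)
              (δ-off-diagonal (λ I₁≡K → I₁≢J₁ (trans I₁≡K K≡J₁))) (δ-off-diagonal (I≢I₁ ∘ sym))
              (δ-off-diagonal I₁≢J₁) (δ-diagonal I₁) (δ-off-diagonal I₁≢J₂)
              (δ-off-diagonal (λ I₁≡I₂ → I≢I₁ (trans I≡I₂ (sym I₁≡I₂)))))) λ ()
      ... | yes I₁≡J₂ | j , β≡ , i↝j , j₂≋j = split i↝j j↝k β≡ α≡
        where
        C≡A : C ≡ A
        C≡A = split-coefficientsᵃ (evaluate (balanced-at k) (δ-diagonal K) (δ-off-diagonal (I≢K ∘ sym)) (δ-≡ K≡J₁)
                (δ-off-diagonal (λ K≡I₁ → I₁≢J₁ (trans (sym K≡I₁) K≡J₁))) (δ-off-diagonal K≢J₂)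
                (δ-off-diagonal (λ K≡I₂ → I≢K (sym (trans K≡I₂ (sym I≡I₂))))))
        C≡B : C ≡ B
        C≡B = split-coefficientsᵇ (evaluate (balanced-at i) (δ-off-diagonal I≢K) (δ-diagonal I)
                (δ-off-diagonal (λ I≡J₁ → I≢K (trans I≡J₁ (sym K≡J₁)))) (δ-off-diagonal I≢I₁)
                (δ-off-diagonal (λ I≡J₂ → I₂≢J₂ (trans (sym I≡I₂) I≡J₂))) (δ-≡ I≡I₂))
        cancel : ∀ {x y z} → C * x ≡ A * y + B * z → y ≡ x - z
        cancel {x} {y} {z} e = trans (sym (lemma y z)) (cong (_- z) (sym (*-cancelˡ-≡ C x (y + z)
                                 (trans e (trans (cong₂ (λ p q → p * y + q * z) (sym C≡A) (sym C≡B)) (sym (*-distribˡ-+ C y z)))))))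
          where
          lemma : ∀ y z → y + z - z ≡ y
          lemma = solve-∀
        α≡ : α ≡ root j k
        α≡ = V-ext (λ r → trans (cancel (trans (coords r) (cong (λ v → A * coord α r + B * coord v r) β≡)))
                                (sym (proj₁ (root-difference i j k) r)))
                   (trans (cancel (trans heights (cong (λ v → A * height α + B * height v) β≡)))
                          (sym (proj₂ (root-difference i j k))))
        j↝k : IsRoot j k
        j↝k with root-injective {i₁} {j₁} {j} {k} i₁↝j₁ α≡
        ... | i₁≋j , k-j≡ = 0<j-i⇒i<j (subst (0ℤ <_) (sym k-j≡) (i<j⇒0<j-i (proj₁ i₁↝j₁))) ,
                            λ j≋k → proj₂ i₁↝j₁ (≋-trans i₁≋j (≋-trans j≋k (residue≡⇒≋ K≡J₁)))

  +ᵥ-comm : ∀ (u v : V n) → u +ᵥ v ≡ v +ᵥ u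
  +ᵥ-comm u v = V-ext (λ r → trans (coord-+ᵥ u v r) (trans (+-comm (coord u r) (coord v r)) (sym (coord-+ᵥ v u r))))
                      (+-comm (height u) (height v))

  cone-shape : ∀ {i k i₁ j₁ i₂ j₂} → IsRoot i k → IsRoot i₁ j₁ → IsRoot i₂ j₂ →
               InCone n (root i k) (root i₁ j₁) (root i₂ j₂) → Shape± i k (root i₁ j₁) (root i₂ j₂)
  cone-shape {i} {k} {i₁} {j₁} {i₂} {j₂} i↝k i₁↝j₁ i₂↝j₂ (ℕ.suc a , ℕ.suc b , ℕ.suc c , _ , _ , _ , eq) =
    dispatch (K ℕ.≟ J₁) (I ℕ.≟ I₁) (K ℕ.≟ J₂) (I ℕ.≟ I₂)
    where
    module M = Classify i↝k i₁↝j₁ i₂↝j₂ a b c eq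
    module M′ = Classify i↝k i₂↝j₂ i₁↝j₁ b a c
                  (trans eq (+ᵥ-comm (ℕ.suc a ·ᵥ root i₁ j₁) (ℕ.suc b ·ᵥ root i₂ j₂)))
    open M using (I; K; I₁; J₁; I₂; J₂)
    dispatch : Dec (K ≡ J₁) → Dec (I ≡ I₁) → Dec (K ≡ J₂) → Dec (I ≡ I₂) → Shape± i k (root i₁ j₁) (root i₂ j₂)
    dispatch (yes K≡J₁) (yes I≡I₁) _ _ = M.parallel K≡J₁ I≡I₁
    dispatch _ _ (yes K≡J₂) (yes I≡I₂) = swap (M′.parallel K≡J₂ I≡I₂)
    dispatch (yes K≡J₁) (no I≢I₁) (no K≢J₂) (yes I≡I₂) = inj₂ (M.split-shape K≡J₁ I≡I₂ I≢I₁ K≢J₂)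
    dispatch (no K≢J₁) (yes I≡I₁) (yes K≡J₂) (no I≢I₂) = inj₁ (M′.split-shape K≡J₂ I≡I₁ I≢I₂ K≢J₁)
    dispatch (no K≢J₁) _ (no K≢J₂) _ = ⊥-elim (either K≢J₁ K≢J₂ M.K-end)
    dispatch _ (no I≢I₁) _ (no I≢I₂) = ⊥-elim (either I≢I₁ I≢I₂ M.I-start)

module Closure (n : ℕ) .{{_ : NonZero n}} where

  open Congruence n
  open Reachability n
  open Roots n

  data Cl (S : Pred (V n) 0ℓ) : Pred (V n) 0ℓ where
    base : ∀ {v} → S v → Φ⁺ n v → Cl S v
    step : ∀ {α β γ} → Cl S α → Cl S β → Φ⁺ n γ → InCone n γ α β → Cl S γ

  Cl⊆Φ⁺ : ∀ {S} → Cl S ⊆ Φ⁺ n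
  Cl⊆Φ⁺ (base _ φ) = φ
  Cl⊆Φ⁺ (step _ _ φ _) = φ

  Cl-closed : ∀ {S} → Closed n (Cl S)
  Cl-closed _ _ _ = step

  Cl-least : ∀ {S} (C : Pred (V n) 0ℓ) → Closed n C → S ⊆ C → Cl S ⊆ C
  Cl-least C C-closed S⊆C (base s _) = S⊆C s
  Cl-least C C-closed S⊆C (step cα cβ φ cone) = C-closed _ _ _ (Cl-least C C-closed S⊆C cα) (Cl-least C C-closed S⊆C cβ) φ cone

  private
    IsRoot-≋ʳ : ∀ {i k k₁} → IsRoot i k → k ≋ k₁ → i < k₁ → IsRoot i k₁
    IsRoot-≋ʳ (_ , i≉k) k≋k₁ i<k₁ = i<k₁ , λ i≋k₁ → i≉k (≋-trans i≋k₁ (≋-sym k≋k₁))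

  module _ (S : Pred (V n) 0ℓ) (S-coclosed : Coclosed n S) where

    Sᵖ : ℤ → ℤ → Set
    Sᵖ i j = IsRoot i j × S (root i j)

    private
      Sᵖ-shift : ∀ {a b} t → Sᵖ a b → Sᵖ (a ⊕ t) (b ⊕ t)
      Sᵖ-shift {a} {b} t (a↝b , s) = IsRoot-shift t a↝b , subst S (sym (root-shift a b t)) s

      outside : ∀ {i j} → IsRoot i j → ¬ Sᵖ i j → Compl n S (root i j)
      outside i↝j ¬s = IsRoot⇒Φ⁺ i↝j , λ s → ¬s (i↝j , s)

      Sᵖ-cosplit : ∀ {a b c} → Sᵖ a c → a < b → b < c → ¬ a ≋ b → ¬ b ≋ c → ¬ Sᵖ a b → ¬ Sᵖ b c → ⊥
      Sᵖ-cosplit {a} {b} {c} (a↝c , s) a<b b<c a≉b b≉c ¬ab ¬bc =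
        proj₂ (S-coclosed _ _ _ (outside (a<b , a≉b) ¬ab) (outside (b<c , b≉c) ¬bc) (IsRoot⇒Φ⁺ a↝c) (cone-split {a} {b} {c})) s

      Sᵖ-cowrap : ∀ {a b x} → Sᵖ a b → x ≋ b → a < x → x < b → ¬ Sᵖ a x →
                  ∀ {b' a'} → b ≋ b' → a ≋ a' → b' < a' → ¬ Sᵖ b' a' → ⊥
      Sᵖ-cowrap {a} {b} {x} (a↝b , s) x≋b a<x x<b ¬ax {b'} {a'} b≋b' a≋a' b'<a' ¬b'a' =
        proj₂ (S-coclosed _ _ _ (outside a↝x ¬ax) (outside b'↝a' ¬b'a') (IsRoot⇒Φ⁺ a↝b)
                (cone-wrap a↝x (≋-sym x≋b) x<b b'↝a' b≋b' a≋a')) s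
        where
        a↝x : IsRoot a x
        a↝x = a<x , λ a≋x → proj₂ a↝b (≋-trans a≋x x≋b)
        b'↝a' : IsRoot b' a'
        b'↝a' = b'<a' , λ b'≋a' → proj₂ a↝b (≋-trans a≋a' (≋-sym (≋-trans b≋b' b'≋a')))

    open Over Sᵖ proj₁ Sᵖ-shift Sᵖ-cosplit Sᵖ-cowrap

    Clᵖ : ℤ → ℤ → Set
    Clᵖ i j = IsRoot i j × Cl S (root i j)

    private
      Clᵖ-shift : ∀ {a b} t → Clᵖ a b → Clᵖ (a ⊕ t) (b ⊕ t)
      Clᵖ-shift {a} {b} t (a↝b , c) = IsRoot-shift t a↝b , subst (Cl S) (sym (root-shift a b t)) c

      Clᵖ-split : ∀ {i j k} → Clᵖ i j → Clᵖ j k → ¬ i ≋ k → Clᵖ i k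
      Clᵖ-split {i} {j} {k} (i↝j , cij) (j↝k , cjk) i≉k =
        i↝k , step cij cjk (IsRoot⇒Φ⁺ i↝k) (cone-split {i} {j} {k})
        where
        i↝k : IsRoot i k
        i↝k = <-trans (proj₁ i↝j) (proj₁ j↝k) , i≉k

      Clᵖ-fan : ∀ {i k k₁ k₂} → Clᵖ i k₁ → Clᵖ i k₂ → k ≋ k₁ → k ≋ k₂ → k₁ < k → k < k₂ → Clᵖ i k
      Clᵖ-fan {i} {k} (i↝k₁ , c₁) (_ , c₂) k≋k₁ k≋k₂ k₁<k k<k₂ =
        i↝k , step c₁ c₂ (IsRoot⇒Φ⁺ i↝k) (cone-fan {i} k≋k₁ k≋k₂ k₁<k k<k₂)
        where
        i↝k : IsRoot i k
        i↝k = <-trans (proj₁ i↝k₁) k₁<k , λ i≋k → proj₂ i↝k₁ (≋-trans i≋k k≋k₁)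

      Clᵖ-wrap : ∀ {i k k₁ k' i'} → Clᵖ i k₁ → k ≋ k₁ → k₁ < k → k ≋ k' → i ≋ i' → Clᵖ k' i' → Clᵖ i k
      Clᵖ-wrap {i} {k} (i↝k₁ , c₁) k≋k₁ k₁<k k≋k' i≋i' (k'↝i' , c₂) =
        i↝k , step c₁ c₂ (IsRoot⇒Φ⁺ i↝k) (cone-wrap i↝k₁ k≋k₁ k₁<k k'↝i' k≋k' i≋i')
        where
        i↝k : IsRoot i k
        i↝k = <-trans (proj₁ i↝k₁) k₁<k , λ i≋k → proj₂ i↝k₁ (≋-trans i≋k k≋k₁)

    open Minimal Clᵖ proj₁ (λ (r , s) → r , base s (IsRoot⇒Φ⁺ r)) Clᵖ-shift Clᵖ-split Clᵖ-fan Clᵖ-wrap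

    NotReach MaybeReach : V n → Set
    NotReach v = ∀ {c d} → IsRoot c d → v ≡ root c d → ¬ Reach c d
    MaybeReach v = ∀ {c d} → IsRoot c d → v ≡ root c d → ¬ ¬ Reach c d

    ¬Cl⇒NotReach : ∀ {v} → ¬ Cl S v → NotReach v
    ¬Cl⇒NotReach ¬c c↝d refl c⇝d = ¬c (proj₂ (Reach⇒R c⇝d (proj₂ c↝d)))

    Shape-closed : ∀ {a b α β} → IsRoot a b → Shape a b α β → MaybeReach α → MaybeReach β → ¬ ¬ Reach a b
    Shape-closed a↝b (split a↝j j↝b α≡ β≡) Rα Rβ ¬a⇝b =
      Rα a↝j α≡ λ a⇝j → Rβ j↝b β≡ λ j⇝b → ¬a⇝b (a⇝j ++ j⇝b)
    Shape-closed a↝b (fan k≋k₁ k≋k₂ a<k₁ k₁<k k<k₂ α≡ β≡) Rα Rβ ¬a⇝b =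
      Rα (IsRoot-≋ʳ a↝b k≋k₁ a<k₁) α≡ λ a⇝k₁ →
      Rβ (IsRoot-≋ʳ a↝b k≋k₂ (<-trans a<k₁ (<-trans k₁<k k<k₂))) β≡ λ a⇝k₂ →
        Reach-fan a⇝k₁ a⇝k₂ k≋k₁ k≋k₂ k₁<k k<k₂ ¬a⇝b
    Shape-closed a↝b (wrap k≋k₁ a<k₁ k₁<k α≡ k'↝i' k≋k' a≋i' β≡) Rα Rβ ¬a⇝b =
      Rα (IsRoot-≋ʳ a↝b k≋k₁ a<k₁) α≡ λ a⇝k₁ →
      Rβ k'↝i' β≡ λ k'⇝i' → ¬a⇝b (Reach-wrap a⇝k₁ k≋k₁ k₁<k k≋k' a≋i' k'⇝i')
    Shape-closed a↝b (same α≡) Rα Rβ = Rα a↝b α≡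

    Shape-coclosed : ∀ {a b α β} → IsRoot a b → Shape a b α β → NotReach α → NotReach β → ¬ Reach a b
    Shape-coclosed a↝b (split a↝j j↝b α≡ β≡) ¬Rα ¬Rβ a⇝b =
      Reach-cosplit a⇝b (proj₁ a↝j) (proj₁ j↝b) (¬Rα a↝j α≡) (¬Rβ j↝b β≡)
    Shape-coclosed a↝b (fan k≋k₁ k≋k₂ a<k₁ k₁<k k<k₂ α≡ β≡) ¬Rα ¬Rβ a⇝b =
      Reach-cofan a⇝b k≋k₁ k≋k₂ a<k₁ k₁<k k<k₂ (¬Rα (IsRoot-≋ʳ a↝b k≋k₁ a<k₁) α≡)
        (¬Rβ (IsRoot-≋ʳ a↝b k≋k₂ (<-trans a<k₁ (<-trans k₁<k k<k₂))) β≡)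
    Shape-coclosed a↝b (wrap k≋k₁ a<k₁ k₁<k α≡ k'↝i' k≋k' a≋i' β≡) ¬Rα ¬Rβ a⇝b =
      Reach-cowrap a⇝b k≋k₁ a<k₁ k₁<k (¬Rα (IsRoot-≋ʳ a↝b k≋k₁ a<k₁) α≡)
        k≋k' a≋i' (proj₁ k'↝i') (¬Rβ k'↝i' β≡)
    Shape-coclosed a↝b (same α≡) ¬Rα ¬Rβ = ¬Rα a↝b α≡

    Cl⇒MaybeReach : ∀ {v} → Cl S v → MaybeReach v
    Cl⇒MaybeReach (base s _) a↝b refl ¬a⇝b = ¬a⇝b (S⇒Reach (a↝b , s))
    Cl⇒MaybeReach (step cα cβ _ cone) a↝b refl with Φ⁺⇒IsRoot (Cl⊆Φ⁺ cα) | Φ⁺⇒IsRoot (Cl⊆Φ⁺ cβ)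
    ... | _ , _ , r₁ , refl | _ , _ , r₂ , refl with cone-shape a↝b r₁ r₂ cone
    ...   | inj₁ shape = Shape-closed a↝b shape (Cl⇒MaybeReach cα) (Cl⇒MaybeReach cβ)
    ...   | inj₂ shape = Shape-closed a↝b shape (Cl⇒MaybeReach cβ) (Cl⇒MaybeReach cα)

    Cl-coclosed : Coclosed n (Cl S)
    Cl-coclosed α β γ (φα , ¬cα) (φβ , ¬cβ) φγ cone with Φ⁺⇒IsRoot φα | Φ⁺⇒IsRoot φβ | Φ⁺⇒IsRoot φγ
    ... | _ , _ , r₁ , refl | _ , _ , r₂ , refl | _ , _ , a↝b , refl =
      φγ , λ cγ → Cl⇒MaybeReach cγ a↝b refl (coclosed (cone-shape a↝b r₁ r₂ cone))
      where
      coclosed : Shape± _ _ α β → ¬ Reach _ _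
      coclosed (inj₁ shape) = Shape-coclosed a↝b shape (¬Cl⇒NotReach ¬cα) (¬Cl⇒NotReach ¬cβ)
      coclosed (inj₂ shape) = Shape-coclosed a↝b shape (¬Cl⇒NotReach ¬cβ) (¬Cl⇒NotReach ¬cα)

module Lattice (n : ℕ) .{{_ : NonZero n}} where

  open Closure n

  Closed-resp-≐ : ∀ {ℓ₁ ℓ₂} {P : Pred (V n) ℓ₁} {Q : Pred (V n) ℓ₂} → P ≐ Q → Closed n P → Closed n Q
  Closed-resp-≐ (P⊆Q , Q⊆P) P-closed α β γ α∈Q β∈Q φ cone = P⊆Q (P-closed α β γ (Q⊆P α∈Q) (Q⊆P β∈Q) φ cone)

  Coclosed-resp-≐ : ∀ {ℓ₁ ℓ₂} {P : Pred (V n) ℓ₁} {Q : Pred (V n) ℓ₂} → P ≐ Q → Coclosed n P → Coclosed n Q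
  Coclosed-resp-≐ (P⊆Q , Q⊆P) = Closed-resp-≐ ((λ (φ , v∉P) → φ , v∉P ∘ Q⊆P) , (λ (φ , v∉Q) → φ , v∉Q ∘ P⊆Q))

  ⋃-coclosed : ∀ {I : Set} {𝒳 : I → Pred (V n) 0ℓ} → (∀ x → Coclosed n (𝒳 x)) → Coclosed n (⋃ I 𝒳)
  ⋃-coclosed 𝒳-coclosed α β γ (φα , α∉) (φβ , β∉) φγ cone =
    φγ , λ (x , γ∈) → proj₂ (𝒳-coclosed x α β γ (φα , α∉ ∘ (x ,_)) (φβ , β∉ ∘ (x ,_)) φγ cone) γ∈

  ⋂-closed : ∀ {I : Set} {𝒳 : I → Pred (V n) 0ℓ} → (∀ x → Closed n (𝒳 x)) → Closed n (⋂ I 𝒳)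
  ⋂-closed 𝒳-closed α β γ α∈ β∈ φ cone x = 𝒳-closed x α β γ (α∈ x) (β∈ x) φ cone

  closure-closed : ∀ {K : Pred (V n) 0ℓ} → Closed n (closure n K)
  closure-closed α β γ (_ , α∈) (_ , β∈) φ cone =
    φ , λ C C⊆Φ⁺ C-closed K⊆C → C-closed α β γ (α∈ C C⊆Φ⁺ C-closed K⊆C) (β∈ C C⊆Φ⁺ C-closed K⊆C) φ cone

  closure-upper : ∀ {K : Pred (V n) 0ℓ} → K ⊆ Φ⁺ n → K ⊆ closure n K
  closure-upper K⊆Φ⁺ k = K⊆Φ⁺ k , λ _ _ _ K⊆C → K⊆C k

  closure-least : ∀ {K : Pred (V n) 0ℓ} (L : Pred (V n) 0ℓ) → Biclosed n L → K ⊆ L → closure n K ⊆ L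
  closure-least L (L⊆Φ⁺ , L-closed , _) K⊆L (_ , least) = least L L⊆Φ⁺ L-closed K⊆L

  closure≐Cl : ∀ {K : Pred (V n) 0ℓ} → K ⊆ Φ⁺ n → Cl K ≐ closure n K
  closure≐Cl {K} K⊆Φ⁺ =
    (λ c → Cl⊆Φ⁺ c , λ C _ C-closed K⊆C → Cl-least C C-closed K⊆C c) ,
    (λ (_ , least) → least (Cl K) Cl⊆Φ⁺ Cl-closed (λ k → base k (K⊆Φ⁺ k)))

  closure-biclosed : ∀ {K : Pred (V n) 0ℓ} → K ⊆ Φ⁺ n → Coclosed n K → Biclosed n (closure n K)
  closure-biclosed {K} K⊆Φ⁺ K-coclosed =
    proj₁ , closure-closed , Coclosed-resp-≐ (closure≐Cl K⊆Φ⁺) (Cl-coclosed K K-coclosed)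

  -- Φ⁺ ∖ Cl (Φ⁺ ∖ K), intersected with K: constructively, being outside Cl (Φ⁺ ∖ K) only gives ¬ ¬ K.
  Int : Pred (V n) 0ℓ → Pred (V n) 0ℓ
  Int K v = Φ⁺ n v × K v × ¬ Cl (Compl n K) v

  Compl-coclosed : ∀ {K : Pred (V n) 0ℓ} → Closed n K → Coclosed n (Compl n K)
  Compl-coclosed K-closed α β γ (φα , α∉) (φβ , β∉) φγ cone =
    φγ , λ (_ , γ∉K) → α∉ (φα , λ α∈K → β∉ (φβ , λ β∈K → γ∉K (K-closed α β γ α∈K β∈K φγ cone)))

  Int-closed : ∀ {K : Pred (V n) 0ℓ} → Closed n K → Closed n (Int K)
  Int-closed {K} K-closed α β γ (φα , α∈K , α∉) (φβ , β∈K , β∉) φγ cone =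
    φγ , K-closed α β γ α∈K β∈K φγ cone ,
    proj₂ (Cl-coclosed (Compl n K) (Compl-coclosed K-closed) α β γ (φα , α∉) (φβ , β∉) φγ cone)

  Int-coclosed : ∀ {K : Pred (V n) 0ℓ} → Coclosed n (Int K)
  Int-coclosed {K} α β γ (φα , α∉) (φβ , β∉) φγ cone =
    φγ , λ (_ , _ , γ∉) → in-Cl α φα α∉ (λ cα → in-Cl β φβ β∉ (λ cβ → γ∉ (step cα cβ φγ cone)))
    where
    in-Cl : ∀ v → Φ⁺ n v → ¬ Int K v → ¬ ¬ Cl (Compl n K) v
    in-Cl v φ v∉ v∉Cl = v∉Cl (base (φ , λ v∈K → v∉ (φ , v∈K , v∉Cl)) φ)

  interior≐Int : ∀ {K : Pred (V n) 0ℓ} → Int K ≐ interior n K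
  interior≐Int {K} =
    (λ v∈ → Int K , proj₁ , Int-coclosed , proj₁ ∘ proj₂ , v∈) ,
    λ (C , C⊆Φ⁺ , C-coclosed , C⊆K , v∈C) →
      C⊆Φ⁺ v∈C , C⊆K v∈C , λ v∈Cl → proj₂ (Cl-least (Compl n C) C-coclosed (λ (φ , v∉K) → φ , v∉K ∘ C⊆K) v∈Cl) v∈C

  interior-biclosed : ∀ {K : Pred (V n) 0ℓ} → Closed n K → Biclosed n (interior n K)
  interior-biclosed K-closed =
    (λ (_ , C⊆Φ⁺ , _ , _ , v∈C) → C⊆Φ⁺ v∈C) ,
    Closed-resp-≐ interior≐Int (Int-closed K-closed) ,
    Coclosed-resp-≐ interior≐Int Int-coclosed

  interior-lower : ∀ {K : Pred (V n) 0ℓ} → interior n K ⊆ K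
  interior-lower (_ , _ , _ , C⊆K , v∈C) = C⊆K v∈C

  interior-greatest : ∀ {K : Pred (V n) 0ℓ} (L : Pred (V n) 0ℓ) → Biclosed n L → L ⊆ K → L ⊆ interior n K
  interior-greatest L (L⊆Φ⁺ , _ , L-coclosed) L⊆K v∈L = L , L⊆Φ⁺ , L-coclosed , L⊆K , v∈L

theorem2p2 : (n : ℕ) .{{_ : NonZero n}} (I : Set) (𝒳 : I → Pred (V n) 0ℓ) →
    (∀ x → Biclosed n (𝒳 x)) →
    -- ⋁ 𝒳 = closure of the union: an element of the poset, an upper bound, the least one
    ((Σ (Pred (V n) 0ℓ) λ J → J ≐ closure n (⋃ I 𝒳))
     × Biclosed n (closure n (⋃ I 𝒳))
     × (∀ x → 𝒳 x ⊆ closure n (⋃ I 𝒳))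
     × ((K : Pred (V n) 0ℓ) → Biclosed n K → (∀ x → 𝒳 x ⊆ K) → closure n (⋃ I 𝒳) ⊆ K))
    ×
    -- ⋀ 𝒳 = interior of the intersection: an element, a lower bound, the greatest one
    ((Σ (Pred (V n) 0ℓ) λ J → J ≐ interior n (⋂ I 𝒳))
     × Biclosed n (interior n (⋂ I 𝒳))
     × (∀ x → interior n (⋂ I 𝒳) ⊆ 𝒳 x)
     × ((K : Pred (V n) 0ℓ) → Biclosed n K → (∀ x → K ⊆ 𝒳 x) → K ⊆ interior n (⋂ I 𝒳)))
theorem2p2 n I 𝒳 𝒳-biclosed =
  ( (Cl U , closure≐Cl U⊆Φ⁺)
  , closure-biclosed U⊆Φ⁺ (⋃-coclosed (proj₂ ∘ proj₂ ∘ 𝒳-biclosed))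
  , (λ x v∈𝒳x → closure-upper U⊆Φ⁺ (x , v∈𝒳x))
  , λ K K-biclosed 𝒳⊆K → closure-least K K-biclosed (λ (x , v∈𝒳x) → 𝒳⊆K x v∈𝒳x))
  ,
  ( (Int M , interior≐Int)
  , interior-biclosed (⋂-closed (proj₁ ∘ proj₂ ∘ 𝒳-biclosed))
  , (λ x v∈ → interior-lower v∈ x)
  , λ K K-biclosed K⊆𝒳 → interior-greatest K K-biclosed (λ v∈K x → K⊆𝒳 x v∈K))
  where
  open Closure n using (Cl)
  open Lattice n
  U M : Pred (V n) 0ℓ
  U = ⋃ I 𝒳
  M = ⋂ I 𝒳
  U⊆Φ⁺ : U ⊆ Φ⁺ n
  U⊆Φ⁺ (x , v∈𝒳x) = proj₁ (𝒳-biclosed x) v∈𝒳x
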